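{- Let $N\ge2$ and consider the flat clusteron with one violinist in each of the rooms $0,1,\dots,N-1$. A state is a final state reachable from this flat clusteron if and only if it is one of the following: (i) the state with shadow $F_{N,1}$ whose leftmost violinist is in room $-N+1$; (ii) the state with shadow $F_{N,N-1}$ whose leftmost violinist is in room $-1$; (iii) for some $1\le r\le N-1$ and some integer $k$ with $-N+2\le k\le -2$, the state with shadow $F_{N,r}$ whose leftmost violinist is in room $k$.
   Context: Rooms are indexed by the integers, room $i$ being adjacent to rooms $i-1$ and $i+1$. A state is a placement of finitely many indistinguishable violinists in rooms: a function $a:\mathbb{Z}\to\mathbb{Z}_{\ge0}$ with finite support, $a_i$ the number of violinists in room $i$. Room $i$ is occupied if $a_i\ge1$. A move is possible whenever two adjacent rooms $i,i+1$ are both occupied: one violinist leaves room $i$ and goes to the nearest unoccupied room to the left of $i$, and one violinist leaves room $i+1$ and goes to the nearest unoccupied room to the right of $i+1$. A state is final if no move is possible. A state is reachable from $S$ if it is obtained from $S$ by a finite (possibly empty) sequence of moves. A flat clusteron is a state in which a set of consecutive rooms each contain exactly one violinist and all other rooms are empty. For a state with at most one violinist per room, its shadow is the $0/1$ word recording occupancy of rooms from its leftmost to its rightmost occupied room. For $N\ge2$ and $1\le k\le N-1$, $F_{N,k}$ denotes the shadow with $N$ ones in which consecutive ones are separated by a single $0$, except that the $k$-th and $(k+1)$-st ones are separated by $00$ (e.g. $F_{3,2}=101001$). -}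

module Defs where

open import Data.Nat as ℕ using (ℕ; zero; suc)
open import Data.Integer as ℤ using (ℤ; +_; -[1+_]; _+_; _-_; -_; ∣_∣)
open import Data.Bool using (Bool; true; false; if_then_else_; _∧_)
open import Data.List using (List; []; _∷_; _++_; concatMap; map; upTo; replicate)
open import Data.Product using (Σ; ∃; ∃-syntax; _×_; _,_)
open import Relation.Binary.PropositionalEquality using (_≡_; _≢_)
open import Relation.Nullary using (¬_)
open import Relation.Nullary.Decidable using (⌊_⌋)

-- A (candidate) state: number of violinists in each room.
State : Set
State = ℤ → ℕ

FiniteSupport : State → Set
FiniteSupport a = ∃[ B ] (∀ i → B ℕ.< ∣ i ∣ → a i ≡ 0)

Occupied : State → ℤ → Set
Occupied a i = 1 ℕ.≤ a i

-- Move S T : T is obtained from S by one move (at the adjacent pair i, i+1).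
-- l is the nearest unoccupied room to the left of i, r the nearest unoccupied
-- room to the right of i+1.
Move : State → State → Set
Move S T =
  Σ ℤ λ i → Σ ℤ λ l → Σ ℤ λ r →
    Occupied S i × Occupied S (i + ℤ.1ℤ) ×
    l ℤ.< i × S l ≡ 0 × (∀ j → l ℤ.< j → j ℤ.< i → Occupied S j) ×
    (i + ℤ.1ℤ) ℤ.< r × S r ≡ 0 × (∀ j → (i + ℤ.1ℤ) ℤ.< j → j ℤ.< r → Occupied S j) ×
    T i ℕ.+ 1 ≡ S i × T (i + ℤ.1ℤ) ℕ.+ 1 ≡ S (i + ℤ.1ℤ) ×
    T l ≡ 1 × T r ≡ 1 ×
    (∀ j → j ≢ i → j ≢ i + ℤ.1ℤ → j ≢ l → j ≢ r → T j ≡ S j)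

data Reachable (S : State) : State → Set where
  here : ∀ {T} → (∀ i → T i ≡ S i) → Reachable S T
  step : ∀ {T U} → Reachable S T → Move T U → Reachable S U

-- Final: no move possible, i.e. no two adjacent occupied rooms.
Final : State → Set
Final a = ¬ (Σ ℤ λ i → Occupied a i × Occupied a (i + ℤ.1ℤ))

flat : ℕ → State
flat N i = if ⌊ + 0 ℤ.≤? i ⌋ ∧ ⌊ i ℤ.<? + N ⌋ then 1 else 0

letter : List Bool → ℕ → ℕ
letter [] _ = 0
letter (b ∷ w) zero = if b then 1 else 0
letter (b ∷ w) (suc n) = letter w n

-- The state with at-most-one-per-room whose shadow is w (w starting with 1)
-- and whose leftmost occupied room is p.
fromShadow : List Bool → ℤ → State
fromShadow w p i with i - p
... | + n = letter w n
... | -[1+ n ] = 0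

HasShadowAt : State → List Bool → ℤ → Set
HasShadowAt a w p = ∀ i → a i ≡ fromShadow w p i

-- F_{N,k}: N ones, consecutive ones separated by 0, except 00 between the
-- k-th and (k+1)-st ones.
F : ℕ → ℕ → List Bool
F N k = true ∷ concatMap gap (map suc (upTo (N ℕ.∸ 1)))
  where
  gap : ℕ → List Bool
  gap j = (if ⌊ j ℕ.≟ k ⌋ then false ∷ false ∷ [] else false ∷ []) ++ true ∷ []

module Submission where

-- After the first move every reachable state has at most one violinist per
-- room, so it is a placed word (p , W), and a move rewrites a factor
-- 0 1^(a+1) 1^(c+1) 0 of W into 1^(a+1) 0 0 1^(c+1) (an end 0 may be the empty
-- room just outside W).  Three finite automata give an invariant of the
-- reachable words: P always accepts, Q while the right end is still in room N,
-- R while the left end is still in room -1.  Since runs of 1s saturate the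
-- automata, preservation under rewriting reduces to finitely many checks, and
-- language inclusions are certified by simulation relations.  A final word has
-- no 11, so P forces it to be 1 (01)^x 00 1 (01)^y = F_{N,x+1}; the number of
-- violinists, the length and the automata Q and R then leave exactly the
-- listed positions.  Conversely every listed state is reached by explicit
-- move sequences, built by appending a violinist on the right and by mirroring.

open import Defs
open import Data.Nat as ℕ using (ℕ; zero; suc; _+_; _<_; _≤_; _∸_; z≤n; s≤s)
import Data.Nat.Properties as ℕP
open import Data.Integer as ℤ using (ℤ; +_; -[1+_]; -_)
import Data.Integer.Properties as ℤP
open import Data.Bool using (Bool; true; false; _∧_; _∨_; not; if_then_else_)
open import Data.List using (List; []; _∷_; _++_; length; replicate; reverse; take; drop; concatMap; map; applyUpTo)
open import Data.Bool.ListAction using (all; any)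
import Data.List.Properties as LP
open import Data.Product using (Σ; _×_; _,_; proj₁; proj₂)
open import Data.Sum using (_⊎_; inj₁; inj₂)
open import Data.Empty using (⊥; ⊥-elim)
open import Data.Unit using (⊤; tt)
open import Relation.Binary.PropositionalEquality
open import Relation.Binary.Definitions using (tri<; tri≈; tri>; DecidableEquality)
open import Relation.Nullary using (¬_; yes; no)
open import Relation.Nullary.Decidable using (⌊_⌋; map′)
import Data.Bool.Properties as BP
open import Data.Product.Properties using () renaming (≡-dec to ×-≡-dec)
open import Function.Bundles using (_⇔_; mk⇔)
open import Relation.Binary.Construct.Closure.ReflexiveTransitive using (Star; ε; _◅_; _◅◅_; gmap; return)
open import Function.Base using (_∘_)
import Data.Integer.Tactic.RingSolver as ZS
import Data.Nat.Tactic.RingSolver as NS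

-- Shadows

ones : ℕ → List Bool
ones n = replicate n true

bit : Bool → ℕ
bit true = 1
bit false = 0

letterℤ : List Bool → ℤ → ℕ
letterℤ W (+ n) = letter W n
letterℤ W -[1+ n ] = 0

fromShadow-letterℤ : ∀ W p i → fromShadow W p i ≡ letterℤ W (i ℤ.- p)
fromShadow-letterℤ W p i with i ℤ.- p
... | + n = refl
... | -[1+ n ] = refl

+-minus-cancelˡ : ∀ (p x : ℤ) → (p ℤ.+ x) ℤ.- p ≡ x
+-minus-cancelˡ = ZS.solve-∀

+-minus-inverse : ∀ (j p : ℤ) → j ≡ p ℤ.+ (j ℤ.- p)
+-minus-inverse = ZS.solve-∀

fromShadow-at : ∀ W p k → fromShadow W p (p ℤ.+ + k) ≡ letter W k
fromShadow-at W p k = trans (fromShadow-letterℤ W p (p ℤ.+ + k)) (cong (letterℤ W) (+-minus-cancelˡ p (+ k)))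

fromShadow-before : ∀ W p n → fromShadow W p (p ℤ.+ -[1+ n ]) ≡ 0
fromShadow-before W p n = trans (fromShadow-letterℤ W p (p ℤ.+ -[1+ n ])) (cong (letterℤ W) (+-minus-cancelˡ p -[1+ n ]))

fromShadow-cong : ∀ {W W'} p → W ≡ W' → fromShadow W p ≗ fromShadow W' p
fromShadow-cong p refl i = refl

fromShadow-false∷ : ∀ W p → fromShadow (false ∷ W) (ℤ.pred p) ≗ fromShadow W p
fromShadow-false∷ W p i = begin
  fromShadow (false ∷ W) (ℤ.pred p) i    ≡⟨ fromShadow-letterℤ _ _ i ⟩
  letterℤ (false ∷ W) (i ℤ.- ℤ.pred p)   ≡⟨ cong (letterℤ (false ∷ W)) (minus-pred i p) ⟩
  letterℤ (false ∷ W) (ℤ.1ℤ ℤ.+ (i ℤ.- p)) ≡⟨ letterℤ-false∷ (i ℤ.- p) ⟩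
  letterℤ W (i ℤ.- p)                    ≡⟨ fromShadow-letterℤ W p i ⟨
  fromShadow W p i                       ∎
  where
  open ≡-Reasoning
  minus-pred : ∀ (i p : ℤ) → i ℤ.- (ℤ.-1ℤ ℤ.+ p) ≡ ℤ.1ℤ ℤ.+ (i ℤ.- p)
  minus-pred = ZS.solve-∀
  letterℤ-false∷ : ∀ x → letterℤ (false ∷ W) (ℤ.1ℤ ℤ.+ x) ≡ letterℤ W x
  letterℤ-false∷ (+ n) = refl
  letterℤ-false∷ -[1+ zero ] = refl
  letterℤ-false∷ -[1+ suc n ] = refl

letter-++-false : ∀ W k → letter (W ++ false ∷ []) k ≡ letter W k
letter-++-false [] zero = refl
letter-++-false [] (suc k) = refl
letter-++-false (x ∷ W) zero = refl
letter-++-false (x ∷ W) (suc k) = letter-++-false W k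

fromShadow-++-false : ∀ W p → fromShadow (W ++ false ∷ []) p ≗ fromShadow W p
fromShadow-++-false W p i =
  trans (fromShadow-letterℤ _ _ i) (trans (letterℤ-++-false (i ℤ.- p)) (sym (fromShadow-letterℤ W p i)))
  where
  letterℤ-++-false : ∀ x → letterℤ (W ++ false ∷ []) x ≡ letterℤ W x
  letterℤ-++-false (+ n) = letter-++-false W n
  letterℤ-++-false -[1+ n ] = refl

letter-0or1 : ∀ W k → letter W k ≡ 0 ⊎ letter W k ≡ 1
letter-0or1 [] k = inj₁ refl
letter-0or1 (true ∷ W) zero = inj₂ refl
letter-0or1 (false ∷ W) zero = inj₁ refl
letter-0or1 (x ∷ W) (suc k) = letter-0or1 W k

1≤letter⇒≡1 : ∀ W k → 1 ≤ letter W k → letter W k ≡ 1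
1≤letter⇒≡1 W k h with letter-0or1 W k
... | inj₂ e = e
... | inj₁ e with subst (1 ≤_) e h
... | ()

letter-beyond : ∀ W k → length W ≤ k → letter W k ≡ 0
letter-beyond [] k _ = refl
letter-beyond (x ∷ W) (suc k) (s≤s le) = letter-beyond W k le

letter-within : ∀ W k → 1 ≤ letter W k → k < length W
letter-within [] k ()
letter-within (x ∷ W) zero _ = s≤s z≤n
letter-within (x ∷ W) (suc k) h = s≤s (letter-within W k h)

letter-++ˡ : ∀ u w k → k < length u → letter (u ++ w) k ≡ letter u k
letter-++ˡ (x ∷ u) w zero _ = refl
letter-++ˡ (x ∷ u) w (suc k) (s≤s lt) = letter-++ˡ u w k lt

letter-++ʳ : ∀ u w k → letter (u ++ w) (length u + k) ≡ letter w k
letter-++ʳ [] w k = refl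
letter-++ʳ (x ∷ u) w k = letter-++ʳ u w k

letter-ones : ∀ m k → k < m → letter (ones m) k ≡ 1
letter-ones (suc m) zero _ = refl
letter-ones (suc m) (suc k) (s≤s lt) = letter-ones m k lt

-- Word moves

-- A placed word (p , W) stands for the state fromShadow W p; a word move
-- records one move on such a state, by where the two empty target rooms lie:
-- both inside W, just left of W, just right of W, or on both sides.
Config : Set
Config = ℤ × List Bool

⟦_⟧ : Config → State
⟦ p , W ⟧ = fromShadow W p

data WordMove : Config → Config → Set where
  inner    : ∀ p u v a c → WordMove (p , u ++ false ∷ ones (suc a) ++ ones (suc c) ++ false ∷ v)
                                    (p , u ++ ones (suc a) ++ false ∷ false ∷ ones (suc c) ++ v)
  leftEnd  : ∀ p v a c → WordMove (p , ones (suc a) ++ ones (suc c) ++ false ∷ v)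
                                  (ℤ.pred p , ones (suc a) ++ false ∷ false ∷ ones (suc c) ++ v)
  rightEnd : ∀ p u a c → WordMove (p , u ++ false ∷ ones (suc a) ++ ones (suc c))
                                  (p , u ++ ones (suc a) ++ false ∷ false ∷ ones (suc c))
  bothEnds : ∀ p a c → WordMove (p , ones (suc a) ++ ones (suc c))
                                (ℤ.pred p , ones (suc a) ++ false ∷ false ∷ ones (suc c))

window : List Bool → ℕ → ℕ → List Bool → Bool → Bool → Bool → Bool → List Bool
window u a c v x₁ x₂ x₃ x₄ = u ++ x₁ ∷ ones a ++ x₂ ∷ x₃ ∷ ones c ++ x₄ ∷ v

windowEnd : ℕ → ℕ → ℕ
windowEnd a c = suc (suc (suc (a + c)))

letter-ones-++ : ∀ a Z k → letter (ones a ++ Z) (a + k) ≡ letter Z k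
letter-ones-++ zero Z k = refl
letter-ones-++ (suc a) Z k = letter-ones-++ a Z k

letter-ones-++ʳ : ∀ a Z k → letter (ones a ++ Z) (k + a) ≡ letter Z k
letter-ones-++ʳ a Z k = subst (λ t → letter (ones a ++ Z) t ≡ letter Z k) (ℕP.+-comm a k) (letter-ones-++ a Z k)

letter-ones-++-< : ∀ a Z k → k < a → letter (ones a ++ Z) k ≡ 1
letter-ones-++-< (suc a) Z zero _ = refl
letter-ones-++-< (suc a) Z (suc k) (s≤s lt) = letter-ones-++-< a Z k lt

letter-head : ∀ x (Z : List Bool) → letter (x ∷ Z) 0 ≡ bit x
letter-head true Z = refl
letter-head false Z = refl

module _ (x₁ x₂ x₃ x₄ : Bool) (a c : ℕ) (v : List Bool) where
  private
    W = window [] a c v x₁ x₂ x₃ x₄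

  window-x₂ : letter W (suc a) ≡ bit x₂
  window-x₂ = trans (letter-ones-++ʳ a (x₂ ∷ x₃ ∷ ones c ++ x₄ ∷ v) 0) (letter-head x₂ (x₃ ∷ ones c ++ x₄ ∷ v))

  window-x₃ : letter W (suc (suc a)) ≡ bit x₃
  window-x₃ = trans (letter-ones-++ʳ a (x₂ ∷ x₃ ∷ ones c ++ x₄ ∷ v) 1) (letter-head x₃ (ones c ++ x₄ ∷ v))

  window-x₄ : letter W (windowEnd a c) ≡ bit x₄
  window-x₄ = begin
    letter (ones a ++ x₂ ∷ x₃ ∷ ones c ++ x₄ ∷ v) (suc (suc (a + c)))
      ≡⟨ cong (letter (ones a ++ x₂ ∷ x₃ ∷ ones c ++ x₄ ∷ v)) (sym (trans (ℕP.+-suc a (suc c)) (cong suc (ℕP.+-suc a c)))) ⟩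
    letter (ones a ++ x₂ ∷ x₃ ∷ ones c ++ x₄ ∷ v) (a + suc (suc c))
      ≡⟨ letter-ones-++ a _ (suc (suc c)) ⟩
    letter (ones c ++ x₄ ∷ v) c
      ≡⟨ letter-ones-++ʳ c _ 0 ⟩
    letter (x₄ ∷ v) 0
      ≡⟨ letter-head x₄ v ⟩
    bit x₄
      ∎
    where open ≡-Reasoning

letter-ones-11-ones : ∀ a c Z k → k < suc (suc (a + c)) → letter (ones a ++ true ∷ true ∷ ones c ++ Z) k ≡ 1
letter-ones-11-ones zero c Z zero _ = refl
letter-ones-11-ones zero c Z (suc zero) _ = refl
letter-ones-11-ones zero c Z (suc (suc k)) (s≤s (s≤s lt)) = letter-ones-++-< c Z k lt
letter-ones-11-ones (suc a) c Z zero _ = refl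
letter-ones-11-ones (suc a) c Z (suc k) (s≤s lt) = letter-ones-11-ones a c Z k lt

window-block : ∀ x₁ x₄ a c v k → 0 < k → k < windowEnd a c → letter (window [] a c v x₁ true true x₄) k ≡ 1
window-block x₁ x₄ a c v (suc k) _ (s≤s lt) = letter-ones-11-ones a c (x₄ ∷ v) k lt

letter-ones-x-swap : ∀ c v x y k → k ≢ c → letter (ones c ++ x ∷ v) k ≡ letter (ones c ++ y ∷ v) k
letter-ones-x-swap zero v x y zero ne = ⊥-elim (ne refl)
letter-ones-x-swap zero v x y (suc k) ne = refl
letter-ones-x-swap (suc c) v x y zero ne = refl
letter-ones-x-swap (suc c) v x y (suc k) ne = letter-ones-x-swap c v x y k (ne ∘ cong suc)

letter-ones-xxx-swap : ∀ a c v x₂ x₃ x₄ y₂ y₃ y₄ k → k ≢ a → k ≢ suc a → k ≢ suc (suc (a + c)) →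
  letter (ones a ++ x₂ ∷ x₃ ∷ ones c ++ x₄ ∷ v) k ≡ letter (ones a ++ y₂ ∷ y₃ ∷ ones c ++ y₄ ∷ v) k
letter-ones-xxx-swap zero c v _ _ x₄ _ _ y₄ zero n₂ n₃ n₄ = ⊥-elim (n₂ refl)
letter-ones-xxx-swap zero c v _ _ x₄ _ _ y₄ (suc zero) n₂ n₃ n₄ = ⊥-elim (n₃ refl)
letter-ones-xxx-swap zero c v _ _ x₄ _ _ y₄ (suc (suc k)) n₂ n₃ n₄ =
  letter-ones-x-swap c v x₄ y₄ k (n₄ ∘ cong (suc ∘ suc))
letter-ones-xxx-swap (suc a) c v _ _ _ _ _ _ zero n₂ n₃ n₄ = refl
letter-ones-xxx-swap (suc a) c v x₂ x₃ x₄ y₂ y₃ y₄ (suc k) n₂ n₃ n₄ =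
  letter-ones-xxx-swap a c v x₂ x₃ x₄ y₂ y₃ y₄ k (n₂ ∘ cong suc) (n₃ ∘ cong suc) (n₄ ∘ cong suc)

window-elsewhere : ∀ u a c v x₁ x₂ x₃ x₄ y₁ y₂ y₃ y₄ k →
  k ≢ length u → k ≢ length u + suc a → k ≢ length u + suc (suc a) → k ≢ length u + windowEnd a c →
  letter (window u a c v x₁ x₂ x₃ x₄) k ≡ letter (window u a c v y₁ y₂ y₃ y₄) k
window-elsewhere u a c v x₁ x₂ x₃ x₄ y₁ y₂ y₃ y₄ k n₁ n₂ n₃ n₄ with k ℕ.<? length u
... | yes lt = trans (letter-++ˡ u _ k lt) (sym (letter-++ˡ u _ k lt))
... | no ge with ℕP.m≤n⇒∃[o]m+o≡n (ℕP.≮⇒≥ ge)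
... | zero , refl = ⊥-elim (n₁ (ℕP.+-identityʳ _))
... | suc t , refl = trans (letter-++ʳ u _ (suc t)) (trans
      (letter-ones-xxx-swap a c v x₂ x₃ x₄ y₂ y₃ y₄ t (n₂ ∘ cong (length u ℕ.+_) ∘ cong suc)
         (n₃ ∘ cong (length u ℕ.+_) ∘ cong suc) (n₄ ∘ cong (length u ℕ.+_) ∘ cong suc))
      (sym (letter-++ʳ u _ (suc t))))

offset-view : ∀ q j → (Σ ℕ λ k → j ≡ q ℤ.+ + k) ⊎ (Σ ℕ λ m → j ≡ q ℤ.+ -[1+ m ])
offset-view q j with j ℤ.- q in eq
... | + k = inj₁ (k , trans (+-minus-inverse j q) (cong (ℤ._+_ q) eq))
... | -[1+ m ] = inj₂ (m , trans (+-minus-inverse j q) (cong (ℤ._+_ q) eq))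

+-cancelˡ-<ℤ : ∀ q {x y : ℤ} → q ℤ.+ x ℤ.< q ℤ.+ y → x ℤ.< y
+-cancelˡ-<ℤ q {x} {y} lt = subst₂ ℤ._<_ (+-minus-cancelˡ q x) (+-minus-cancelˡ q y) (ℤP.+-monoˡ-< (ℤ.- q) lt)

offset-mono-< : ∀ q {x y : ℕ} → x < y → q ℤ.+ + x ℤ.< q ℤ.+ + y
offset-mono-< q lt = ℤP.+-monoʳ-< q (ℤ.+<+ lt)

offset-between : ∀ q x y j → q ℤ.+ + x ℤ.< j → j ℤ.< q ℤ.+ + y → Σ ℕ λ k → (j ≡ q ℤ.+ + k) × x < k × k < y
offset-between q x y j lo hi with offset-view q j
... | inj₁ (k , refl) = k , refl , ℤP.drop‿+<+ (+-cancelˡ-<ℤ q lo) , ℤP.drop‿+<+ (+-cancelˡ-<ℤ q hi)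
... | inj₂ (m , refl) with +-cancelˡ-<ℤ q lo
... | ()

offset-suc : ∀ q x → (q ℤ.+ + x) ℤ.+ ℤ.1ℤ ≡ q ℤ.+ + suc x
offset-suc q x = +-suc-assoc q (+ x)
  where +-suc-assoc : ∀ (q x : ℤ) → (q ℤ.+ x) ℤ.+ ℤ.1ℤ ≡ q ℤ.+ (ℤ.1ℤ ℤ.+ x)
        +-suc-assoc = ZS.solve-∀

≡1⇒occupied : ∀ {x : ℕ} → x ≡ 1 → 1 ≤ x
≡1⇒occupied refl = s≤s z≤n

-- The move at rooms (i₀, i₀+1) of the window u 0 1^a 1 1 1^c 0 v turns it into
-- u 1 1^a 0 0 1^c 1 v, and this is the only move with those three rooms.
module WindowFlip (q : ℤ) (u : List Bool) (a c : ℕ) (v : List Bool) where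
  n = length u
  before = window u a c v false true true false
  after  = window u a c v true false false true
  left  = q ℤ.+ + n
  i₀    = q ℤ.+ + (n + suc a)
  i₁    = q ℤ.+ + (n + suc (suc a))
  right = q ℤ.+ + (n + windowEnd a c)

  i₀+1 : i₀ ℤ.+ ℤ.1ℤ ≡ i₁
  i₀+1 = trans (offset-suc q (n + suc a)) (cong (λ t → q ℤ.+ + t) (sym (ℕP.+-suc n (suc a))))

  module _ (x₁ x₂ x₃ x₄ : Bool) where
    W = window u a c v x₁ x₂ x₃ x₄

    at : ∀ t → fromShadow W q (q ℤ.+ + (n + t)) ≡ letter (window [] a c v x₁ x₂ x₃ x₄) t
    at t = trans (fromShadow-at W q (n + t)) (letter-++ʳ u _ t)

    at-left : fromShadow W q left ≡ bit x₁
    at-left = trans (cong (λ t → fromShadow W q (q ℤ.+ + t)) (sym (ℕP.+-identityʳ n)))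
                    (trans (at 0) (letter-head x₁ (ones a ++ x₂ ∷ x₃ ∷ ones c ++ x₄ ∷ v)))

    at-i₀ : fromShadow W q i₀ ≡ bit x₂
    at-i₀ = trans (at (suc a)) (window-x₂ x₁ x₂ x₃ x₄ a c v)

    at-i₁ : fromShadow W q i₁ ≡ bit x₃
    at-i₁ = trans (at (suc (suc a))) (window-x₃ x₁ x₂ x₃ x₄ a c v)

    at-i₀+1 : fromShadow W q (i₀ ℤ.+ ℤ.1ℤ) ≡ bit x₃
    at-i₀+1 = trans (cong (fromShadow W q) i₀+1) at-i₁

    at-right : fromShadow W q right ≡ bit x₄
    at-right = trans (at (windowEnd a c)) (window-x₄ x₁ x₂ x₃ x₄ a c v)

  before-block : ∀ k → n < k → k < n + windowEnd a c → fromShadow before q (q ℤ.+ + k) ≡ 1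
  before-block k lo hi with ℕP.m≤n⇒∃[o]m+o≡n (ℕP.<⇒≤ lo)
  ... | t , refl = trans (at false true true false t)
    (window-block false false a c v t (ℕP.+-cancelˡ-< n 0 t (subst (_< n + t) (sym (ℕP.+-identityʳ n)) lo))
                                      (ℕP.+-cancelˡ-< n t (windowEnd a c) hi))

  after-elsewhere : ∀ j → j ≢ i₀ → j ≢ i₁ → j ≢ left → j ≢ right → fromShadow after q j ≡ fromShadow before q j
  after-elsewhere j n₁ n₂ n₃ n₄ with offset-view q j
  ... | inj₂ (m , refl) = trans (fromShadow-before after q m) (sym (fromShadow-before before q m))
  ... | inj₁ (k , refl) = trans (fromShadow-at after q k) (trans
        (window-elsewhere u a c v _ _ _ _ _ _ _ _ k (n₃ ∘ cong (λ t → q ℤ.+ + t)) (n₁ ∘ cong (λ t → q ℤ.+ + t))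
            (n₂ ∘ cong (λ t → q ℤ.+ + t)) (n₄ ∘ cong (λ t → q ℤ.+ + t)))
        (sym (fromShadow-at before q k)))

  window-isMove : ∀ {S U : State} → S ≗ fromShadow before q → U ≗ fromShadow after q → Move S U
  window-isMove {S} {U} hS hU =
    i₀ , left , right ,
    ≡1⇒occupied (trans (hS i₀) (at-i₀ false true true false)) ,
    ≡1⇒occupied (trans (hS _) (at-i₀+1 false true true false)) ,
    offset-mono-< q (ℕP.m<m+n n (s≤s z≤n)) ,
    trans (hS left) (at-left false true true false) ,
    (λ j lo hi → let (k , e , lo' , hi') = offset-between q n (n + suc a) j lo hi in
        ≡1⇒occupied (trans (hS j) (trans (cong (fromShadow before q) e)
          (before-block k lo' (ℕP.<-trans hi' (ℕP.+-monoʳ-< n (s≤s (s≤s (ℕP.m≤n⇒m≤1+n (ℕP.m≤m+n a c)))))))))) ,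
    subst (ℤ._< right) (sym i₀+1) (offset-mono-< q (ℕP.+-monoʳ-< n (s≤s (s≤s (s≤s (ℕP.m≤m+n a c)))))) ,
    trans (hS right) (at-right false true true false) ,
    (λ j lo hi → let (k , e , lo' , hi') = offset-between q (n + suc (suc a)) (n + windowEnd a c) j (subst (ℤ._< j) i₀+1 lo) hi in
        ≡1⇒occupied (trans (hS j) (trans (cong (fromShadow before q) e)
          (before-block k (ℕP.<-trans (ℕP.m<m+n n (s≤s z≤n)) lo') hi')))) ,
    trans (cong (ℕ._+ 1) (trans (hU i₀) (at-i₀ true false false true))) (sym (trans (hS i₀) (at-i₀ false true true false))) ,
    trans (cong (ℕ._+ 1) (trans (hU _) (at-i₀+1 true false false true))) (sym (trans (hS _) (at-i₀+1 false true true false))) ,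
    trans (hU left) (at-left true false false true) ,
    trans (hU right) (at-right true false false true) ,
    (λ j n₁ n₂ n₃ n₄ → trans (hU j) (trans (after-elsewhere j n₁ (λ e → n₂ (trans e (sym i₀+1))) n₃ n₄) (sym (hS j))))

  window-move-determined : ∀ {S U : State} → S ≗ fromShadow before q → (mv : Move S U) →
    proj₁ mv ≡ i₀ → proj₁ (proj₂ mv) ≡ left → proj₁ (proj₂ (proj₂ mv)) ≡ right → U ≗ fromShadow after q
  window-move-determined {S} {U} hS (i , l , r , _ , _ , _ , _ , _ , _ , _ , _ , Ui , Ui₁ , Ul , Ur , Uo) refl refl refl j
    with j ℤ.≟ i₀ | j ℤ.≟ i₁ | j ℤ.≟ left | j ℤ.≟ right
  ... | yes refl | _ | _ | _ =
    trans (ℕP.+-cancelʳ-≡ 1 _ 0 (trans Ui (trans (hS i₀) (at-i₀ false true true false)))) (sym (at-i₀ true false false true))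
  ... | no _ | yes refl | _ | _ =
    trans (cong U (sym i₀+1)) (trans (ℕP.+-cancelʳ-≡ 1 _ 0 (trans Ui₁ (trans (hS _) (at-i₀+1 false true true false))))
          (sym (at-i₁ true false false true)))
  ... | no _ | no _ | yes refl | _ = trans Ul (sym (at-left true false false true))
  ... | no _ | no _ | no _ | yes refl = trans Ur (sym (at-right true false false true))
  ... | no n₁ | no n₂ | no n₃ | no n₄ =
    trans (Uo j n₁ (λ e → n₂ (trans e i₀+1)) n₃ n₄) (trans (hS j) (sym (after-elsewhere j n₁ n₂ n₃ n₄)))

ones-suc : ∀ a Z → true ∷ (ones a ++ Z) ≡ ones a ++ true ∷ Z
ones-suc zero Z = refl
ones-suc (suc a) Z = cong (true ∷_) (ones-suc a Z)

ones-+ : ∀ a b → ones (a + b) ≡ ones a ++ ones b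
ones-+ zero b = refl
ones-+ (suc a) b = cong (true ∷_) (ones-+ a b)

before-form : ∀ u a c v → u ++ false ∷ ones (suc a) ++ ones (suc c) ++ false ∷ v ≡ window u a c v false true true false
before-form u a c v = cong (λ z → u ++ false ∷ z) (ones-suc a (true ∷ ones c ++ false ∷ v))

after-form : ∀ u a c v → u ++ ones (suc a) ++ false ∷ false ∷ ones (suc c) ++ v ≡ window u a c v true false false true
after-form u a c v = cong (λ z → u ++ true ∷ ones a ++ false ∷ false ∷ z) (ones-suc c v)

snoc-false : ∀ u a c → (u ++ false ∷ ones (suc a) ++ ones (suc c)) ++ false ∷ [] ≡ u ++ false ∷ ones (suc a) ++ ones (suc c) ++ false ∷ []
snoc-false u a c = trans (LP.++-assoc u (false ∷ ones (suc a) ++ ones (suc c)) (false ∷ []))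
                     (cong (λ z → u ++ false ∷ z) (LP.++-assoc (ones (suc a)) (ones (suc c)) (false ∷ [])))

snoc-nil : ∀ u a c → u ++ ones (suc a) ++ false ∷ false ∷ ones (suc c) ≡ u ++ ones (suc a) ++ false ∷ false ∷ ones (suc c) ++ []
snoc-nil u a c = cong (λ z → u ++ ones (suc a) ++ false ∷ false ∷ z) (sym (LP.++-identityʳ (ones (suc c))))

-- Padding the shadow with an empty room on the side(s) where the move leaves
-- the word turns every word move into a window flip.
record AsWindowFlip (c c' : Config) : Set where
  field
    q : ℤ
    u : List Bool
    a c₀ : ℕ
    v : List Bool
    before≗ : ⟦ c ⟧ ≗ fromShadow (WindowFlip.before q u a c₀ v) q
    after≗ : ⟦ c' ⟧ ≗ fromShadow (WindowFlip.after q u a c₀ v) q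

wordMove-asWindowFlip : ∀ {c c'} → WordMove c c' → AsWindowFlip c c'
wordMove-asWindowFlip (inner p u v a c) = record { q = p ; u = u ; a = a ; c₀ = c ; v = v
  ; before≗ = fromShadow-cong p (before-form u a c v) ; after≗ = fromShadow-cong p (after-form u a c v) }
wordMove-asWindowFlip (leftEnd p v a c) = record { q = ℤ.pred p ; u = [] ; a = a ; c₀ = c ; v = v
  ; before≗ = λ i → trans (sym (fromShadow-false∷ _ p i)) (fromShadow-cong (ℤ.pred p) (before-form [] a c v) i)
  ; after≗ = fromShadow-cong (ℤ.pred p) (after-form [] a c v) }
wordMove-asWindowFlip (rightEnd p u a c) = record { q = p ; u = u ; a = a ; c₀ = c ; v = []
  ; before≗ = λ i → trans (sym (fromShadow-++-false _ p i))
                     (fromShadow-cong p (trans (snoc-false u a c) (before-form u a c [])) i)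
  ; after≗ = fromShadow-cong p (trans (snoc-nil u a c) (after-form u a c [])) }
wordMove-asWindowFlip (bothEnds p a c) = record { q = ℤ.pred p ; u = [] ; a = a ; c₀ = c ; v = []
  ; before≗ = λ i → trans (sym (fromShadow-++-false _ p i))
               (trans (sym (fromShadow-false∷ _ p i))
                      (fromShadow-cong (ℤ.pred p) (trans (snoc-false [] a c) (before-form [] a c [])) i))
  ; after≗ = fromShadow-cong (ℤ.pred p) (trans (snoc-nil [] a c) (after-form [] a c [])) }

wordMove⇒Move : ∀ {c c'} {S U : State} → WordMove c c' → S ≗ ⟦ c ⟧ → U ≗ ⟦ c' ⟧ → Move S U
wordMove⇒Move st hS hU = let open AsWindowFlip (wordMove-asWindowFlip st) in
  WindowFlip.window-isMove q u a c₀ v (λ i → trans (hS i) (before≗ i)) (λ i → trans (hU i) (after≗ i))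

split-ones : ∀ W b m → (∀ t → t < m → letter W (b + t) ≡ 1) → b + m ≤ length W →
  W ≡ take b W ++ ones m ++ drop (b + m) W
split-ones W zero zero h le = refl
split-ones (true ∷ W) zero (suc m) h (s≤s le) = cong (true ∷_) (split-ones W zero m (λ t lt → h (suc t) (s≤s lt)) le)
split-ones (false ∷ W) zero (suc m) h le with h 0 (s≤s z≤n)
... | ()
split-ones (x ∷ W) (suc b) m h (s≤s le) = cong (x ∷_) (split-ones W b m h le)

take-suc-empty : ∀ W n → letter W n ≡ 0 → n < length W → take (suc n) W ≡ take n W ++ false ∷ []
take-suc-empty (false ∷ W) zero e lt = refl
take-suc-empty (true ∷ W) zero () lt
take-suc-empty (x ∷ W) (suc n) e (s≤s lt) = cong (x ∷_) (take-suc-empty W n e lt)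

drop-empty : ∀ W n → letter W n ≡ 0 → n < length W → drop n W ≡ false ∷ drop (suc n) W
drop-empty (false ∷ W) zero e lt = refl
drop-empty (true ∷ W) zero () lt
drop-empty (x ∷ W) (suc n) e (s≤s lt) = drop-empty W n e lt

drop-length : ∀ (W : List Bool) → drop (length W) W ≡ []
drop-length [] = refl
drop-length (x ∷ W) = drop-length W

length-take-≤ : ∀ n (W : List Bool) → n ≤ length W → length (take n W) ≡ n
length-take-≤ zero W _ = refl
length-take-≤ (suc n) (x ∷ W) (s≤s le) = cong suc (length-take-≤ n W le)

ones-around-pair : ∀ (W : List Bool) b i e → (∀ k → b ≤ k → k < i → letter W k ≡ 1) →
  letter W i ≡ 1 → letter W (suc i) ≡ 1 → (∀ k → suc i < k → k < e → letter W k ≡ 1) →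
  ∀ k → b ≤ k → k < e → letter W k ≡ 1
ones-around-pair W b i e hl h₀ h₁ hr k lo hi with ℕP.<-cmp k i
... | tri< lt _ _ = hl k lo lt
... | tri≈ _ refl _ = h₀
... | tri> _ _ gt with ℕP.<-cmp k (suc i)
... | tri< lt _ _ = ⊥-elim (ℕP.<-irrefl refl (ℕP.<-≤-trans gt (ℕP.≤-pred lt)))
... | tri≈ _ refl _ = h₁
... | tri> _ _ gt' = hr k gt' hi

wordMove-result : ∀ {S U : State} {c c'} (st : WordMove c c') → S ≗ ⟦ c ⟧ → (mv : Move S U) →
  let open AsWindowFlip (wordMove-asWindowFlip st) in
  proj₁ mv ≡ WindowFlip.i₀ q u a c₀ v → proj₁ (proj₂ mv) ≡ WindowFlip.left q u a c₀ v →
  proj₁ (proj₂ (proj₂ mv)) ≡ WindowFlip.right q u a c₀ v → U ≗ ⟦ c' ⟧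
wordMove-result st hS mv ei el er i = let open AsWindowFlip (wordMove-asWindowFlip st) in
  trans (WindowFlip.window-move-determined q u a c₀ v (λ j → trans (hS j) (before≗ j)) mv ei el er i) (sym (after≗ i))

reassociate : ∀ (u Y : List Bool) (a c : ℕ) →
  (u ++ false ∷ []) ++ (ones (suc a) ++ ones (suc c)) ++ Y ≡ u ++ false ∷ ones (suc a) ++ ones (suc c) ++ Y
reassociate u Y a c = trans (LP.++-assoc u (false ∷ []) _) (cong (λ z → u ++ false ∷ z) (LP.++-assoc (ones (suc a)) (ones (suc c)) Y))

ℕ-identity₁ : ∀ nl a c → nl + suc (suc (suc (a + c))) ≡ suc (suc (suc nl + a)) + c
ℕ-identity₁ = NS.solve-∀

ℕ-identity₂ : ∀ nl a c → suc nl + (suc a + suc c) ≡ suc (suc (suc nl + a)) + c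
ℕ-identity₂ = NS.solve-∀

ℕ-identity₃ : ∀ a c → suc a + suc c ≡ suc (suc a) + c
ℕ-identity₃ a c = cong suc (ℕP.+-suc a c)

pred-offset : ∀ (p x : ℤ) → p ℤ.+ x ≡ (ℤ.-1ℤ ℤ.+ p) ℤ.+ (ℤ.1ℤ ℤ.+ x)
pred-offset = ZS.solve-∀

pred-offset-0 : ∀ (p : ℤ) → p ℤ.+ -[1+ 0 ] ≡ (ℤ.-1ℤ ℤ.+ p) ℤ.+ + 0
pred-offset-0 p = trans (ℤP.+-comm p -[1+ 0 ]) (sym (ℤP.+-identityʳ _))

-- In a move on a state with shadow W, the empty room reached on either side
-- is a letter of W or the room just outside W.
module ShadowMove (S : State) (p : ℤ) (W : List Bool) (hS : S ≗ fromShadow W p) where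
  at : ∀ k → S (p ℤ.+ + k) ≡ letter W k
  at k = trans (hS _) (fromShadow-at W p k)

  at-before : ∀ m → S (p ℤ.+ -[1+ m ]) ≡ 0
  at-before m = trans (hS _) (fromShadow-before W p m)

  occupied-letter : ∀ j → 1 ≤ S j → Σ ℕ λ k → (j ≡ p ℤ.+ + k) × letter W k ≡ 1
  occupied-letter j o with offset-view p j
  ... | inj₁ (k , refl) = k , refl , 1≤letter⇒≡1 W k (subst (1 ≤_) (at k) o)
  ... | inj₂ (m , refl) with subst (1 ≤_) (at-before m) o
  ... | ()

  occupied-between : ∀ (lo : ℤ) x y → lo ℤ.≤ p ℤ.+ + x → (∀ j → lo ℤ.< j → j ℤ.< p ℤ.+ + y → 1 ≤ S j) →
    ∀ k → x < k → k < y → letter W k ≡ 1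
  occupied-between lo x y lox h k xk ky =
    1≤letter⇒≡1 W k (subst (1 ≤_) (at k) (h _ (ℤP.≤-<-trans lox (offset-mono-< p xk)) (offset-mono-< p ky)))

  data LeftRoom (l : ℤ) (i : ℕ) : Set where
    inside  : (k : ℕ) → l ≡ p ℤ.+ + k → letter W k ≡ 0 → k < i → (∀ j → k < j → j < i → letter W j ≡ 1) → LeftRoom l i
    outside : l ≡ p ℤ.+ -[1+ 0 ] → (∀ j → j < i → letter W j ≡ 1) → LeftRoom l i

  leftRoom : ∀ l i → l ℤ.< p ℤ.+ + i → S l ≡ 0 → (∀ j → l ℤ.< j → j ℤ.< p ℤ.+ + i → 1 ≤ S j) → LeftRoom l i
  leftRoom l i lt Sl h with offset-view p l
  ... | inj₁ (k , refl) = inside k refl (trans (sym (at k)) Sl) (ℤP.drop‿+<+ (+-cancelˡ-<ℤ p lt))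
                             (occupied-between (p ℤ.+ + k) k i ℤP.≤-refl h)
  ... | inj₂ (zero , refl) = outside refl (λ j ji → 1≤letter⇒≡1 W j (subst (1 ≤_) (at j)
                                  (h _ (ℤP.+-monoʳ-< p ℤ.-<+) (offset-mono-< p ji))))
  ... | inj₂ (suc m , refl)
    with subst (1 ≤_) (at-before 0) (h (p ℤ.+ -[1+ 0 ]) (ℤP.+-monoʳ-< p (ℤ.-<- (s≤s z≤n))) (ℤP.+-monoʳ-< p ℤ.-<+))
  ... | ()

  data RightRoom (r : ℤ) (i : ℕ) : Set where
    inside  : (k : ℕ) → r ≡ p ℤ.+ + k → letter W k ≡ 0 → k < length W → suc i < k →
              (∀ j → suc i < j → j < k → letter W j ≡ 1) → RightRoom r i
    outside : r ≡ p ℤ.+ + length W → suc i < length W → (∀ j → suc i < j → j < length W → letter W j ≡ 1) → RightRoom r i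

  rightRoom : ∀ r i → letter W (suc i) ≡ 1 → p ℤ.+ + suc i ℤ.< r → S r ≡ 0 →
    (∀ j → p ℤ.+ + suc i ℤ.< j → j ℤ.< r → 1 ≤ S j) → RightRoom r i
  rightRoom r i Wi₁ lt Sr h with offset-view p r
  ... | inj₂ (m , refl) with +-cancelˡ-<ℤ p lt
  ... | ()
  rightRoom r i Wi₁ lt Sr h | inj₁ (k , refl) with ℕP.<-cmp k (length W)
  ... | tri< k<len _ _ = inside k refl (trans (sym (at k)) Sr) k<len (ℤP.drop‿+<+ (+-cancelˡ-<ℤ p lt))
                                (occupied-between _ (suc i) k ℤP.≤-refl h)
  ... | tri≈ _ refl _ = outside refl i₁<len (occupied-between _ (suc i) k ℤP.≤-refl h)
    where i₁<len = letter-within W (suc i) (subst (1 ≤_) (sym Wi₁) (s≤s z≤n))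
  ... | tri> _ _ gt
    with trans (sym (occupied-between _ (suc i) k ℤP.≤-refl h (length W)
                      (letter-within W (suc i) (subst (1 ≤_) (sym Wi₁) (s≤s z≤n))) gt))
               (letter-beyond W (length W) ℕP.≤-refl)
  ... | ()

  Realised : ∀ {U : State} → Move S U → Set
  Realised {U} _ = Σ Config λ c' → WordMove (p , W) c' × U ≗ ⟦ c' ⟧

  realise : ∀ {U} {W₀ c'} (mv : Move S U) (st : WordMove (p , W₀) c') → W ≡ W₀ →
    let open AsWindowFlip (wordMove-asWindowFlip st) in
    proj₁ mv ≡ WindowFlip.i₀ q u a c₀ v → proj₁ (proj₂ mv) ≡ WindowFlip.left q u a c₀ v →
    proj₁ (proj₂ (proj₂ mv)) ≡ WindowFlip.right q u a c₀ v → Realised mv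
  realise {c' = c'} mv st refl ei el er = c' , st , wordMove-result st hS mv ei el er

  Move⇒wordMove : ∀ {U : State} (mv : Move S U) → Realised mv
  Move⇒wordMove mv@(i , l , r , oi , oi₁ , l<i , Sl , bl , i₁<r , Sr , br , _) with occupied-letter i oi
  ... | ni , ei , Wi = cases (leftRoom l ni (subst (l ℤ.<_) ei l<i) Sl (λ j x y → bl j x (subst (j ℤ.<_) (sym ei) y)))
                             (rightRoom r ni Wi₁ (subst (ℤ._< r) ei₁ i₁<r) Sr (λ j x y → br j (subst (ℤ._< j) (sym ei₁) x) y))
    where
    ei₁ : i ℤ.+ ℤ.1ℤ ≡ p ℤ.+ + suc ni
    ei₁ = trans (cong (ℤ._+ ℤ.1ℤ) ei) (offset-suc p ni)
    Wi₁ : letter W (suc ni) ≡ 1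
    Wi₁ = 1≤letter⇒≡1 W (suc ni) (subst (1 ≤_) (trans (cong S ei₁) (at (suc ni))) oi₁)
    at-offset : ∀ {x y} → x ≡ y → p ℤ.+ + x ≡ p ℤ.+ + y
    at-offset = cong (λ z → p ℤ.+ + z)
    block : ∀ b e → (∀ k → b ≤ k → k < ni → letter W k ≡ 1) → (∀ k → suc ni < k → k < e → letter W k ≡ 1) →
            ∀ m → b + m ≡ e → ∀ t → t < m → letter W (b + t) ≡ 1
    block b e hl hr m refl t t<m =
      ones-around-pair W b ni e hl Wi Wi₁ hr (b + t) (ℕP.m≤m+n b t) (ℕP.+-monoʳ-< b t<m)
    cases : LeftRoom l ni → RightRoom r ni → Realised mv
    cases (inside nl el Wl nl<ni hl) (inside nr er Wr nr<len ni<nr hr)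
      with ℕP.m≤n⇒∃[o]m+o≡n nl<ni | ℕP.m≤n⇒∃[o]m+o≡n ni<nr
    ... | a , refl | c , refl =
      realise mv (inner p u v a c) eqW
        (trans ei (at-offset (trans (sym (ℕP.+-suc nl a)) (cong (ℕ._+ suc a) (sym lu)))))
        (trans el (at-offset (sym lu)))
        (trans er (at-offset (trans (sym (ℕ-identity₁ nl a c)) (cong (ℕ._+ windowEnd a c) (sym lu)))))
      where
      u = take nl W
      v = drop (suc nr) W
      nl<len = ℕP.<-trans nl<ni (ℕP.<-trans (ℕP.n<1+n ni) (ℕP.<-trans ni<nr nr<len))
      lu : length u ≡ nl
      lu = length-take-≤ nl W (ℕP.<⇒≤ nl<len)
      eqW : W ≡ u ++ false ∷ ones (suc a) ++ ones (suc c) ++ false ∷ v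
      eqW = trans (split-ones W (suc nl) (suc a + suc c) (block (suc nl) nr (λ k → hl k) hr _ (ℕ-identity₂ nl a c))
                              (subst (_≤ length W) (sym (ℕ-identity₂ nl a c)) (ℕP.<⇒≤ nr<len)))
            (trans (cong₂ _++_ (take-suc-empty W nl Wl nl<len)
                     (cong₂ _++_ (ones-+ (suc a) (suc c)) (trans (cong (λ z → drop z W) (ℕ-identity₂ nl a c)) (drop-empty W nr Wr nr<len))))
                   (reassociate u (false ∷ v) a c))
    cases (outside el hl) (inside nr er Wr nr<len ni<nr hr) with ℕP.m≤n⇒∃[o]m+o≡n ni<nr
    ... | c , refl =
      realise mv (leftEnd p v ni c) eqW (trans ei (pred-offset p (+ ni))) (trans el (pred-offset-0 p))
        (trans er (pred-offset p (+ suc (suc (ni + c)))))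
      where
      v = drop (suc nr) W
      eqW : W ≡ ones (suc ni) ++ ones (suc c) ++ false ∷ v
      eqW = trans (split-ones W 0 (suc ni + suc c) (block 0 nr (λ k _ → hl k) hr _ (ℕ-identity₃ ni c))
                              (subst (_≤ length W) (sym (ℕ-identity₃ ni c)) (ℕP.<⇒≤ nr<len)))
            (trans (cong₂ _++_ (ones-+ (suc ni) (suc c)) (trans (cong (λ z → drop z W) (ℕ-identity₃ ni c)) (drop-empty W nr Wr nr<len)))
                   (LP.++-assoc (ones (suc ni)) (ones (suc c)) (false ∷ v)))
    cases (inside nl el Wl nl<ni hl) (outside er ni<len hr)
      with ℕP.m≤n⇒∃[o]m+o≡n nl<ni | ℕP.m≤n⇒∃[o]m+o≡n ni<len
    ... | a , refl | c , ec =
      realise mv (rightEnd p u a c) eqW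
        (trans ei (at-offset (trans (sym (ℕP.+-suc nl a)) (cong (ℕ._+ suc a) (sym lu)))))
        (trans el (at-offset (sym lu)))
        (trans er (at-offset (trans (sym ec) (trans (sym (ℕ-identity₁ nl a c)) (cong (ℕ._+ windowEnd a c) (sym lu))))))
      where
      u = take nl W
      nl<len = ℕP.<-trans nl<ni (ℕP.<-trans (ℕP.n<1+n ni) ni<len)
      lu : length u ≡ nl
      lu = length-take-≤ nl W (ℕP.<⇒≤ nl<len)
      eqW : W ≡ u ++ false ∷ ones (suc a) ++ ones (suc c)
      eqW = trans (split-ones W (suc nl) (suc a + suc c) (block (suc nl) (length W) (λ k → hl k) hr _ (trans (ℕ-identity₂ nl a c) ec))
                              (ℕP.≤-reflexive (trans (ℕ-identity₂ nl a c) ec)))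
            (trans (cong₂ _++_ (take-suc-empty W nl Wl nl<len)
                     (cong₂ _++_ (ones-+ (suc a) (suc c)) (trans (cong (λ z → drop z W) (trans (ℕ-identity₂ nl a c) ec)) (drop-length W))))
                   (trans (reassociate u [] a c) (cong (λ z → u ++ false ∷ ones (suc a) ++ z) (LP.++-identityʳ (ones (suc c))))))
    cases (outside el hl) (outside er ni<len hr) with ℕP.m≤n⇒∃[o]m+o≡n ni<len
    ... | c , ec =
      realise mv (bothEnds p ni c) eqW (trans ei (pred-offset p (+ ni))) (trans el (pred-offset-0 p))
        (trans er (trans (at-offset (sym ec)) (pred-offset p (+ suc (suc (ni + c))))))
      where
      eqW : W ≡ ones (suc ni) ++ ones (suc c)
      eqW = trans (split-ones W 0 (suc ni + suc c) (block 0 (length W) (λ k _ → hl k) hr _ (trans (ℕ-identity₃ ni c) ec))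
                              (ℕP.≤-reflexive (trans (ℕ-identity₃ ni c) ec)))
            (trans (cong₂ _++_ (ones-+ (suc ni) (suc c)) (trans (cong (λ z → drop z W) (trans (ℕ-identity₃ ni c) ec)) (drop-length W)))
                   (trans (LP.++-assoc (ones (suc ni)) (ones (suc c)) []) (cong (ones (suc ni) ++_) (LP.++-identityʳ (ones (suc c))))))

-- Automata

record DFA : Set₁ where
  field
    Q         : Set
    _≟_       : DecidableEquality Q
    δ         : Q → Bool → Q
    accepting : Q → Bool

∧-true : ∀ {x y} → x ∧ y ≡ true → x ≡ true × y ≡ true
∧-true {x} {y} e = BP.∧-conicalˡ x y e , BP.∧-conicalʳ x y e

⇒-true : ∀ {x y} → not x ∨ y ≡ true → x ≡ true → y ≡ true
⇒-true {true} h refl = h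

_⊗_ : DFA → DFA → DFA
A ⊗ B = record
  { Q         = A.Q × B.Q
  ; _≟_       = ×-≡-dec A._≟_ B._≟_
  ; δ         = λ (s , t) b → A.δ s b , B.δ t b
  ; accepting = λ (s , t) → A.accepting s ∧ B.accepting t
  }
  where module A = DFA A
        module B = DFA B

-- Finite certificates, checked by evaluation: a list of states closed under
-- δ contains every state reachable from its members, and a list R of pairs
-- closed under δ in which acceptance of the second component implies
-- acceptance of the first is a simulation, so that L(u) ⊆ L(t) for (t , u) ∈ R.
module DFAProperties (A : DFA) where
  open DFA A public

  run : Q → List Bool → Q
  run s [] = s
  run s (b ∷ w) = run (δ s b) w

  run-++ : ∀ s x y → run s (x ++ y) ≡ run (run s x) y
  run-++ s [] y = refl
  run-++ s (b ∷ x) y = run-++ (δ s b) x y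

  ≟-true : ∀ x y → ⌊ x ≟ y ⌋ ≡ true → x ≡ y
  ≟-true x y e with x ≟ y
  ≟-true x y e | yes p = p
  ≟-true x y () | no _

  _∈ᵇ_ : Q → List Q → Bool
  x ∈ᵇ xs = any (λ y → ⌊ x ≟ y ⌋) xs

  _∈²_ : Q × Q → List (Q × Q) → Bool
  x ∈² xs = any (λ y → ⌊ ×-≡-dec _≟_ _≟_ x y ⌋) xs

  all-∈ᵇ : ∀ (f : Q → Bool) xs x → all f xs ≡ true → x ∈ᵇ xs ≡ true → f x ≡ true
  all-∈ᵇ f (y ∷ ys) x ha hm with x ≟ y
  ... | yes refl = BP.∧-conicalˡ (f y) (all f ys) ha
  ... | no _ = all-∈ᵇ f ys x (BP.∧-conicalʳ (f y) (all f ys) ha) hm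

  all-∈² : ∀ (f : Q × Q → Bool) xs x → all f xs ≡ true → x ∈² xs ≡ true → f x ≡ true
  all-∈² f (y ∷ ys) x ha hm with ×-≡-dec _≟_ _≟_ x y
  ... | yes refl = BP.∧-conicalˡ (f y) (all f ys) ha
  ... | no _ = all-∈² f ys x (BP.∧-conicalʳ (f y) (all f ys) ha) hm

  closedAt : List Q → Q → Bool
  closedAt xs s = (δ s true ∈ᵇ xs) ∧ (δ s false ∈ᵇ xs)

  Closed : List Q → Bool
  Closed xs = all (closedAt xs) xs

  closed-δ : ∀ xs → Closed xs ≡ true → ∀ s b → s ∈ᵇ xs ≡ true → δ s b ∈ᵇ xs ≡ true
  closed-δ xs cl s true m = BP.∧-conicalˡ (δ s true ∈ᵇ xs) _ (all-∈ᵇ (closedAt xs) xs s cl m)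
  closed-δ xs cl s false m = BP.∧-conicalʳ (δ s true ∈ᵇ xs) _ (all-∈ᵇ (closedAt xs) xs s cl m)

  closed-run : ∀ xs → Closed xs ≡ true → ∀ s w → s ∈ᵇ xs ≡ true → run s w ∈ᵇ xs ≡ true
  closed-run xs cl s [] m = m
  closed-run xs cl s (b ∷ w) m = closed-run xs cl (δ s b) w (closed-δ xs cl s b m)

  simulatesAt : List (Q × Q) → Q × Q → Bool
  simulatesAt R (t , u) = ((δ t true , δ u true) ∈² R) ∧ ((δ t false , δ u false) ∈² R) ∧ (not (accepting u) ∨ accepting t)

  Simulation : List (Q × Q) → Bool
  Simulation R = all (simulatesAt R) R

  simulation-sound : ∀ R → Simulation R ≡ true → ∀ t u → (t , u) ∈² R ≡ true →
    ∀ w → accepting (run u w) ≡ true → accepting (run t w) ≡ true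
  simulation-sound R sim t u m w h with all-∈² (simulatesAt R) R (t , u) sim m
  ... | at with ∧-true {(δ t true , δ u true) ∈² R} at
  ... | m₁ , rest with ∧-true {(δ t false , δ u false) ∈² R} rest
  ... | m₀ , acc with w
  ... | [] = ⇒-true acc h
  ... | true ∷ w' = simulation-sound R sim _ _ m₁ w' h
  ... | false ∷ w' = simulation-sound R sim _ _ m₀ w' h

-- A block 1^(a+1) may be replaced by 1^min(a+1,2) once the automaton is
-- saturated (δ s 1 = s after 11), so each kind of word move only has to be
-- checked on the four gap words 1^i 00 1^j with i, j ∈ {1, 2}.
short : ℕ → List Bool
short zero = true ∷ []
short (suc _) = true ∷ true ∷ []

gapWord : ℕ → ℕ → List Bool
gapWord a c = short a ++ false ∷ false ∷ short c

forAllGaps : (List Bool → Bool) → Bool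
forAllGaps f = f (gapWord 0 0) ∧ f (gapWord 0 1) ∧ f (gapWord 1 0) ∧ f (gapWord 1 1)

forAllGaps-sound : ∀ f → forAllGaps f ≡ true → ∀ a c → f (gapWord a c) ≡ true
forAllGaps-sound f h a c with ∧-true {f (gapWord 0 0)} h
... | h₀₀ , h' with ∧-true {f (gapWord 0 1)} h'
... | h₀₁ , h'' with ∧-true {f (gapWord 1 0)} h''
... | h₁₀ , h₁₁ with a | c
... | zero | zero = h₀₀
... | zero | suc _ = h₀₁
... | suc _ | zero = h₁₀
... | suc _ | suc _ = h₁₁

ones-++-ones : ∀ a c → ones (suc a) ++ ones (suc c) ≡ ones (suc (suc (a + c)))
ones-++-ones a c = cong (true ∷_) (trans (sym (ones-+ a (suc c))) (cong ones (ℕP.+-suc a c)))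

module MoveInvariance (A : DFA) (s₀ : DFA.Q A) (Reach : List (DFA.Q A)) (Sim : List (DFA.Q A × DFA.Q A)) where
  open DFAProperties A

  Accepts : List Bool → Set
  Accepts w = accepting (run s₀ w) ≡ true

  saturatedAt : Q → Bool
  saturatedAt s = ⌊ δ (run s (ones 2)) true ≟ run s (ones 2) ⌋

  innerAt : Q → List Bool → Bool
  innerAt s Y = (run s Y , run s (false ∷ true ∷ true ∷ false ∷ [])) ∈² Sim

  leftEndAt : List Bool → Bool
  leftEndAt Y = (run s₀ Y , run s₀ (true ∷ true ∷ false ∷ [])) ∈² Sim

  rightEndAt : Q → List Bool → Bool
  rightEndAt s Y = not (accepting (run s (false ∷ true ∷ true ∷ []))) ∨ accepting (run s Y)

  bothEndsAt : List Bool → Bool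
  bothEndsAt Y = not (accepting (run s₀ (ones 2))) ∨ accepting (run s₀ Y)

  initialAt : List Bool → Bool
  initialAt Y = accepting (run s₀ Y)

  module Sound (closed : Closed Reach ≡ true) (s₀∈ : s₀ ∈ᵇ Reach ≡ true)
               (saturating : all saturatedAt Reach ≡ true) (simulation : Simulation Sim ≡ true) where
    reached : ∀ u → run s₀ u ∈ᵇ Reach ≡ true
    reached u = closed-run Reach closed s₀ u s₀∈

    run-fixed : ∀ t → δ t true ≡ t → ∀ k → run t (ones k) ≡ t
    run-fixed t e zero = refl
    run-fixed t e (suc k) rewrite e = run-fixed t e k

    run-long : ∀ s → s ∈ᵇ Reach ≡ true → ∀ k → run s (ones (suc (suc k))) ≡ run s (ones 2)
    run-long s m k = run-fixed (run s (ones 2)) (≟-true _ _ (all-∈ᵇ saturatedAt Reach s saturating m)) k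

    run-block : ∀ s → s ∈ᵇ Reach ≡ true → ∀ a → run s (ones (suc a)) ≡ run s (short a)
    run-block s m zero = refl
    run-block s m (suc a) = run-long s m a

    run-two-blocks : ∀ s → s ∈ᵇ Reach ≡ true → ∀ a c w →
      run s (ones (suc a) ++ ones (suc c) ++ w) ≡ run (run s (ones 2)) w
    run-two-blocks s m a c w = begin
      run s (ones (suc a) ++ ones (suc c) ++ w)     ≡⟨ cong (run s) (sym (LP.++-assoc (ones (suc a)) (ones (suc c)) w)) ⟩
      run s ((ones (suc a) ++ ones (suc c)) ++ w)   ≡⟨ run-++ s (ones (suc a) ++ ones (suc c)) w ⟩
      run (run s (ones (suc a) ++ ones (suc c))) w  ≡⟨ cong (λ t → run (run s t) w) (ones-++-ones a c) ⟩
      run (run s (ones (suc (suc (a + c))))) w      ≡⟨ cong (λ t → run t w) (run-long s m (a + c)) ⟩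
      run (run s (ones 2)) w                        ∎
      where open ≡-Reasoning

    run-gap : ∀ s → s ∈ᵇ Reach ≡ true → ∀ a c w →
      run s (ones (suc a) ++ false ∷ false ∷ ones (suc c) ++ w) ≡ run (run s (gapWord a c)) w
    run-gap s m a c w = begin
      run s (ones (suc a) ++ false ∷ false ∷ ones (suc c) ++ w)      ≡⟨ run-++ s (ones (suc a)) (false ∷ false ∷ ones (suc c) ++ w) ⟩
      run (run s (ones (suc a))) (false ∷ false ∷ ones (suc c) ++ w)  ≡⟨ cong (λ t → run t (false ∷ false ∷ ones (suc c) ++ w)) (run-block s m a) ⟩
      run s₀₀ (ones (suc c) ++ w)                                     ≡⟨ run-++ s₀₀ (ones (suc c)) w ⟩
      run (run s₀₀ (ones (suc c))) w                                  ≡⟨ cong (λ t → run t w) (run-block s₀₀ s₀₀∈ c) ⟩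
      run (run s₀₀ (short c)) w                                       ≡⟨ cong (λ t → run t w) (sym (run-++ s (short a) (false ∷ false ∷ short c))) ⟩
      run (run s (gapWord a c)) w                                     ∎
      where
      open ≡-Reasoning
      s₀₀ = run (run s (short a)) (false ∷ false ∷ [])
      s₀₀∈ : s₀₀ ∈ᵇ Reach ≡ true
      s₀₀∈ = closed-run Reach closed _ (false ∷ false ∷ []) (closed-run Reach closed s (short a) m)

    accepting-≡ : ∀ {s t} → s ≡ t → accepting t ≡ true → accepting s ≡ true
    accepting-≡ e h = trans (cong accepting e) h

    inner-preserves : all (forAllGaps ∘ innerAt) Reach ≡ true → ∀ u v a c →
      Accepts (u ++ false ∷ ones (suc a) ++ ones (suc c) ++ false ∷ v) →
      Accepts (u ++ ones (suc a) ++ false ∷ false ∷ ones (suc c) ++ v)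
    inner-preserves check u v a c h =
      accepting-≡ (trans (run-++ s₀ u (ones (suc a) ++ false ∷ false ∷ ones (suc c) ++ v)) (run-gap s (reached u) a c v))
        (simulation-sound Sim simulation _ _
          (forAllGaps-sound (innerAt s) (all-∈ᵇ (forAllGaps ∘ innerAt) Reach s check (reached u)) a c) v
          (accepting-≡ (sym (trans (run-++ s₀ u (false ∷ ones (suc a) ++ ones (suc c) ++ false ∷ v))
            (run-two-blocks (δ s false) (closed-δ Reach closed s false (reached u)) a c (false ∷ v)))) h))
      where s = run s₀ u

    leftEnd-preserves : forAllGaps leftEndAt ≡ true → ∀ v a c →
      Accepts (ones (suc a) ++ ones (suc c) ++ false ∷ v) →
      Accepts (ones (suc a) ++ false ∷ false ∷ ones (suc c) ++ v)
    leftEnd-preserves check v a c h =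
      accepting-≡ (run-gap s₀ s₀∈ a c v)
        (simulation-sound Sim simulation _ _ (forAllGaps-sound leftEndAt check a c) v
          (accepting-≡ (sym (run-two-blocks s₀ s₀∈ a c (false ∷ v))) h))

    rightEnd-preserves : all (forAllGaps ∘ rightEndAt) Reach ≡ true → ∀ u a c →
      Accepts (u ++ false ∷ ones (suc a) ++ ones (suc c)) →
      Accepts (u ++ ones (suc a) ++ false ∷ false ∷ ones (suc c))
    rightEnd-preserves check u a c h =
      accepting-≡ (trans (cong (run s₀) (snoc-nil u a c)) (trans (run-++ s₀ u (ones (suc a) ++ false ∷ false ∷ ones (suc c) ++ []))
          (run-gap s (reached u) a c [])))
        (⇒-true (forAllGaps-sound (rightEndAt s) (all-∈ᵇ (forAllGaps ∘ rightEndAt) Reach s check (reached u)) a c)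
          (accepting-≡ (sym (trans (run-++ s₀ u (false ∷ ones (suc a) ++ ones (suc c)))
            (trans (cong (λ w → run s (false ∷ ones (suc a) ++ w)) (sym (LP.++-identityʳ (ones (suc c)))))
              (run-two-blocks (δ s false) (closed-δ Reach closed s false (reached u)) a c [])))) h))
      where s = run s₀ u

    bothEnds-preserves : forAllGaps bothEndsAt ≡ true → ∀ a c →
      Accepts (ones (suc a) ++ ones (suc c)) → Accepts (ones (suc a) ++ false ∷ false ∷ ones (suc c))
    bothEnds-preserves check a c h =
      accepting-≡ (trans (cong (run s₀) (snoc-nil [] a c)) (run-gap s₀ s₀∈ a c []))
        (⇒-true (forAllGaps-sound bothEndsAt check a c)
          (accepting-≡ (sym (trans (cong (λ w → run s₀ (ones (suc a) ++ w)) (sym (LP.++-identityʳ (ones (suc c)))))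
            (run-two-blocks s₀ s₀∈ a c []))) h))

    initial-accepts : forAllGaps initialAt ≡ true → ∀ a c → Accepts (ones (suc a) ++ false ∷ false ∷ ones (suc c))
    initial-accepts check a c =
      accepting-≡ (trans (cong (run s₀) (snoc-nil [] a c)) (run-gap s₀ s₀∈ a c [])) (forAllGaps-sound initialAt check a c)

data Shape : Set where
  start dead one many gap₁ gap₂ : Shape

shape-code : Shape → ℕ
shape-code start = 0
shape-code dead = 1
shape-code one = 2
shape-code many = 3
shape-code gap₁ = 4
shape-code gap₂ = 5

shape-decode : ℕ → Shape
shape-decode 0 = start
shape-decode 1 = dead
shape-decode 2 = one
shape-decode 3 = many
shape-decode 4 = gap₁
shape-decode _ = gap₂

shape-decode-code : ∀ s → shape-decode (shape-code s) ≡ s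
shape-decode-code start = refl
shape-decode-code dead = refl
shape-decode-code one = refl
shape-decode-code many = refl
shape-decode-code gap₁ = refl
shape-decode-code gap₂ = refl

_≟-shape_ : DecidableEquality Shape
s ≟-shape t = map′ (λ e → trans (sym (shape-decode-code s)) (trans (cong shape-decode e) (shape-decode-code t)))
                   (cong shape-code) (shape-code s ℕ.≟ shape-code t)

-- The shape records the end of the word read so far: one (…01 or 1),
-- many (…11), gap₁ (…10) and gap₂ (…100, or longer runs of 0 for Q).
-- P accepts the words that begin and end with 1, contain no 000, and have an
-- occurrence of 11 between any two occurrences of 00; its flag records a 00
-- since the last 11.
P : DFA
P = record { Q = Shape × Bool ; _≟_ = ×-≡-dec _≟-shape_ BP._≟_ ; δ = δ ; accepting = accepting }
  where
  δ : Shape × Bool → Bool → Shape × Bool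
  δ (start , _) true = one , false
  δ (start , _) false = dead , false
  δ (dead , _) _ = dead , false
  δ (one , f) true = many , false
  δ (one , f) false = gap₁ , f
  δ (many , _) true = many , false
  δ (many , _) false = gap₁ , false
  δ (gap₁ , f) true = one , f
  δ (gap₁ , f) false = gap₂ , f
  δ (gap₂ , true) true = dead , false
  δ (gap₂ , false) true = one , true
  δ (gap₂ , _) false = dead , false
  accepting : Shape × Bool → Bool
  accepting (one , _) = true
  accepting (many , _) = true
  accepting _ = false

-- Q accepts the words that begin and end with 1 in which every run of at
-- least two 0s, except possibly the first run of 0s, is followed later by 11;
-- its flags record a 0 so far and such a run not yet followed by 11.
Q : DFA
Q = record { Q = Shape × Bool × Bool ; _≟_ = ×-≡-dec _≟-shape_ (×-≡-dec BP._≟_ BP._≟_) ; δ = δ ; accepting = accepting }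
  where
  δ : Shape × Bool × Bool → Bool → Shape × Bool × Bool
  δ (start , _) true = one , false , false
  δ (start , _) false = dead , false , false
  δ (dead , _) _ = dead , false , false
  δ (one , z , g) true = many , z , false
  δ (one , z , g) false = gap₁ , z , g
  δ (many , z , g) true = many , z , false
  δ (many , z , g) false = gap₁ , z , false
  δ (gap₁ , z , g) true = one , true , g
  δ (gap₁ , z , g) false = gap₂ , z , g
  δ (gap₂ , z , g) true = one , true , g ∨ z
  δ (gap₂ , z , g) false = gap₂ , z , g
  accepting : Shape × Bool × Bool → Bool
  accepting (one , _ , g) = not g
  accepting (many , _ , g) = not g
  accepting _ = false

-- R accepts the words that begin and end with 1 in which a run of at least
-- two 0s not preceded by 11 is the last run of 0s; its flags record an
-- earlier 11 and such a run.
R : DFA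
R = record { Q = Shape × Bool × Bool ; _≟_ = ×-≡-dec _≟-shape_ (×-≡-dec BP._≟_ BP._≟_) ; δ = δ ; accepting = accepting }
  where
  δ : Shape × Bool × Bool → Bool → Shape × Bool × Bool
  δ (start , _) true = one , false , false
  δ (start , _) false = dead , false , false
  δ (dead , _) _ = dead , false , false
  δ (one , h , e) true = many , true , e
  δ (one , h , e) false = gap₁ , h , e
  δ (many , h , e) true = many , true , e
  δ (many , h , e) false = gap₁ , true , e
  δ (gap₁ , h , true) true = dead , false , false
  δ (gap₁ , h , false) true = one , h , false
  δ (gap₁ , h , e) false = gap₂ , h , e
  δ (gap₂ , h , true) true = dead , false , false
  δ (gap₂ , h , false) true = one , h , not h
  δ (gap₂ , h , e) false = gap₂ , h , e
  accepting : Shape × Bool × Bool → Bool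
  accepting (one , _) = true
  accepting (many , _) = true
  accepting _ = false

P-reach : List (DFA.Q P)
P-reach =
  (start , false) ∷ (one , false) ∷ (dead , false) ∷ (many , false) ∷
  (gap₁ , false) ∷ (gap₂ , false) ∷ (one , true) ∷ (gap₁ , true) ∷
  (gap₂ , true) ∷
  []

P-simulation : List (DFA.Q P × DFA.Q P)
P-simulation =
  ((one , true) , (gap₁ , false)) ∷ ((many , false) , (gap₁ , false)) ∷
  ((one , true) , (dead , false)) ∷ ((many , false) , (dead , false)) ∷
  ((dead , false) , (dead , false)) ∷ ((gap₁ , false) , (dead , false)) ∷
  ((one , false) , (dead , false)) ∷ ((gap₂ , false) , (dead , false)) ∷
  ((gap₁ , true) , (dead , false)) ∷ ((gap₂ , true) , (dead , false)) ∷
  ((many , false) , (one , false)) ∷ ((gap₁ , false) , (gap₂ , false)) ∷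
  ((one , false) , (one , true)) ∷ ((many , false) , (many , false)) ∷
  ((gap₁ , false) , (gap₁ , true)) ∷ ((gap₂ , false) , (gap₂ , true)) ∷
  ((gap₁ , false) , (gap₁ , false)) ∷ ((one , false) , (one , false)) ∷
  ((gap₂ , false) , (gap₂ , false)) ∷ ((one , true) , (one , true)) ∷
  ((gap₁ , true) , (gap₁ , true)) ∷ ((gap₂ , true) , (gap₂ , true)) ∷
  ((gap₁ , true) , (gap₂ , false)) ∷
  []

PQ-reach : List (DFA.Q (P ⊗ Q))
PQ-reach =
  ((start , false) , (start , false , false)) ∷ ((one , false) , (one , false , false)) ∷
  ((dead , false) , (dead , false , false)) ∷ ((many , false) , (many , false , false)) ∷
  ((gap₁ , false) , (gap₁ , false , false)) ∷ ((one , false) , (one , true , false)) ∷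
  ((gap₂ , false) , (gap₂ , false , false)) ∷ ((one , true) , (one , true , false)) ∷
  ((dead , false) , (gap₂ , false , false)) ∷ ((dead , false) , (one , true , false)) ∷
  ((dead , false) , (many , true , false)) ∷ ((dead , false) , (gap₁ , true , false)) ∷
  ((dead , false) , (gap₂ , true , false)) ∷ ((dead , false) , (one , true , true)) ∷
  ((dead , false) , (gap₁ , true , true)) ∷ ((dead , false) , (gap₂ , true , true)) ∷
  ((many , false) , (many , true , false)) ∷ ((gap₁ , true) , (gap₁ , true , false)) ∷
  ((gap₂ , true) , (gap₂ , true , false)) ∷ ((gap₁ , false) , (gap₁ , true , false)) ∷
  ((gap₂ , false) , (gap₂ , true , false)) ∷ ((one , true) , (one , true , true)) ∷
  ((gap₁ , true) , (gap₁ , true , true)) ∷ ((gap₂ , true) , (gap₂ , true , true)) ∷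
  []

PQ-simulation : List (DFA.Q (P ⊗ Q) × DFA.Q (P ⊗ Q))
PQ-simulation =
  (((one , true) , (one , true , false)) , ((gap₁ , false) , (gap₁ , false , false))) ∷ (((many , false) , (many , true , false)) , ((gap₁ , false) , (gap₁ , false , false))) ∷
  (((one , true) , (one , true , false)) , ((dead , false) , (dead , false , false))) ∷ (((many , false) , (many , true , false)) , ((dead , false) , (dead , false , false))) ∷
  (((one , true) , (one , true , false)) , ((gap₁ , false) , (gap₁ , true , false))) ∷ (((many , false) , (many , true , false)) , ((gap₁ , false) , (gap₁ , true , false))) ∷
  (((dead , false) , (dead , false , false)) , ((dead , false) , (dead , false , false))) ∷ (((one , true) , (one , true , true)) , ((gap₁ , false) , (gap₁ , true , false))) ∷
  (((dead , false) , (one , true , true)) , ((dead , false) , (gap₁ , true , false))) ∷ (((dead , false) , (many , true , false)) , ((dead , false) , (gap₁ , true , false))) ∷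
  (((one , true) , (one , true , true)) , ((dead , false) , (gap₁ , true , false))) ∷ (((many , false) , (many , true , false)) , ((dead , false) , (gap₁ , true , false))) ∷
  (((many , false) , (many , true , false)) , ((dead , false) , (one , true , false))) ∷ (((gap₁ , false) , (gap₁ , true , false)) , ((dead , false) , (gap₂ , true , false))) ∷
  (((one , false) , (one , true , false)) , ((dead , false) , (one , true , true))) ∷ (((gap₂ , false) , (gap₂ , true , false)) , ((dead , false) , (gap₂ , true , false))) ∷
  (((one , true) , (one , true , true)) , ((dead , false) , (one , true , true))) ∷ (((dead , false) , (gap₂ , true , false)) , ((dead , false) , (gap₂ , true , false))) ∷
  (((dead , false) , (one , true , true)) , ((dead , false) , (one , true , true))) ∷ (((dead , false) , (many , true , false)) , ((dead , false) , (many , true , false))) ∷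
  (((dead , false) , (gap₁ , true , true)) , ((dead , false) , (gap₁ , true , true))) ∷ (((dead , false) , (gap₂ , true , true)) , ((dead , false) , (gap₂ , true , true))) ∷
  (((dead , false) , (gap₁ , true , false)) , ((dead , false) , (gap₁ , true , false))) ∷ (((dead , false) , (one , true , false)) , ((dead , false) , (one , true , false))) ∷
  (((many , false) , (many , true , false)) , ((dead , false) , (many , true , false))) ∷ (((gap₁ , true) , (gap₁ , true , true)) , ((dead , false) , (gap₁ , true , true))) ∷
  (((gap₂ , true) , (gap₂ , true , true)) , ((dead , false) , (gap₂ , true , true))) ∷ (((gap₁ , false) , (gap₁ , true , false)) , ((dead , false) , (gap₁ , true , false))) ∷
  (((one , false) , (one , true , false)) , ((dead , false) , (one , true , false))) ∷ (((gap₁ , false) , (gap₁ , true , false)) , ((dead , false) , (gap₁ , true , true))) ∷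
  (((gap₂ , false) , (gap₂ , true , false)) , ((dead , false) , (gap₂ , true , true))) ∷ (((dead , false) , (gap₂ , true , false)) , ((dead , false) , (gap₂ , true , true))) ∷
  (((gap₁ , true) , (gap₁ , true , true)) , ((dead , false) , (gap₂ , true , false))) ∷ (((gap₂ , true) , (gap₂ , true , true)) , ((dead , false) , (gap₂ , true , false))) ∷
  (((dead , false) , (gap₂ , true , true)) , ((dead , false) , (gap₂ , true , false))) ∷ (((dead , false) , (many , true , false)) , ((dead , false) , (one , true , false))) ∷
  (((dead , false) , (gap₁ , true , false)) , ((dead , false) , (gap₂ , true , false))) ∷ (((dead , false) , (one , true , false)) , ((dead , false) , (one , true , true))) ∷
  (((dead , false) , (gap₁ , true , false)) , ((dead , false) , (gap₁ , true , true))) ∷ (((dead , false) , (gap₁ , true , true)) , ((dead , false) , (gap₂ , true , false))) ∷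
  (((many , false) , (many , true , false)) , ((one , false) , (one , true , false))) ∷ (((gap₁ , true) , (gap₁ , true , true)) , ((gap₂ , false) , (gap₂ , true , false))) ∷
  (((one , true) , (one , true , true)) , ((one , true) , (one , true , true))) ∷ (((many , false) , (many , true , false)) , ((many , false) , (many , true , false))) ∷
  (((gap₁ , true) , (gap₁ , true , true)) , ((gap₁ , true) , (gap₁ , true , true))) ∷ (((gap₂ , true) , (gap₂ , true , true)) , ((gap₂ , true) , (gap₂ , true , true))) ∷
  (((gap₁ , false) , (gap₁ , true , false)) , ((gap₁ , false) , (gap₁ , true , false))) ∷ (((one , false) , (one , true , false)) , ((one , false) , (one , true , false))) ∷
  (((gap₂ , false) , (gap₂ , true , false)) , ((gap₂ , false) , (gap₂ , true , false))) ∷ (((gap₁ , false) , (gap₁ , true , false)) , ((gap₂ , false) , (gap₂ , true , false))) ∷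
  (((one , false) , (one , true , false)) , ((one , true) , (one , true , true))) ∷ (((gap₁ , false) , (gap₁ , true , false)) , ((gap₁ , true) , (gap₁ , true , true))) ∷
  (((gap₂ , false) , (gap₂ , true , false)) , ((gap₂ , true) , (gap₂ , true , true))) ∷ (((gap₁ , true) , (gap₁ , true , false)) , ((gap₂ , false) , (gap₂ , true , false))) ∷
  (((one , true) , (one , true , false)) , ((one , true) , (one , true , true))) ∷ (((gap₂ , true) , (gap₂ , true , false)) , ((dead , false) , (gap₂ , true , false))) ∷
  (((gap₁ , true) , (gap₁ , true , false)) , ((gap₁ , true) , (gap₁ , true , true))) ∷ (((gap₂ , true) , (gap₂ , true , false)) , ((gap₂ , true) , (gap₂ , true , true))) ∷
  (((gap₁ , false) , (gap₁ , true , false)) , ((dead , false) , (dead , false , false))) ∷ (((one , false) , (one , true , false)) , ((dead , false) , (dead , false , false))) ∷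
  (((gap₂ , false) , (gap₂ , true , false)) , ((dead , false) , (dead , false , false))) ∷ (((one , true) , (one , true , true)) , ((dead , false) , (dead , false , false))) ∷
  (((dead , false) , (gap₂ , true , false)) , ((dead , false) , (dead , false , false))) ∷ (((dead , false) , (one , true , true)) , ((dead , false) , (dead , false , false))) ∷
  (((dead , false) , (many , true , false)) , ((dead , false) , (dead , false , false))) ∷ (((dead , false) , (gap₁ , true , true)) , ((dead , false) , (dead , false , false))) ∷
  (((dead , false) , (gap₂ , true , true)) , ((dead , false) , (dead , false , false))) ∷ (((dead , false) , (gap₁ , true , false)) , ((dead , false) , (dead , false , false))) ∷
  (((dead , false) , (one , true , false)) , ((dead , false) , (dead , false , false))) ∷ (((gap₁ , true) , (gap₁ , true , true)) , ((dead , false) , (dead , false , false))) ∷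
  (((gap₂ , true) , (gap₂ , true , true)) , ((dead , false) , (dead , false , false))) ∷ (((gap₁ , true) , (gap₁ , true , false)) , ((dead , false) , (dead , false , false))) ∷
  (((gap₂ , true) , (gap₂ , true , false)) , ((dead , false) , (dead , false , false))) ∷ (((gap₁ , false) , (gap₁ , true , false)) , ((gap₂ , false) , (gap₂ , false , false))) ∷
  (((one , false) , (one , true , false)) , ((one , true) , (one , true , false))) ∷ (((gap₂ , false) , (gap₂ , true , false)) , ((dead , false) , (gap₂ , false , false))) ∷
  (((one , true) , (one , true , true)) , ((dead , false) , (one , true , false))) ∷ (((dead , false) , (gap₂ , true , false)) , ((dead , false) , (gap₂ , false , false))) ∷
  (((dead , false) , (one , true , true)) , ((dead , false) , (one , true , false))) ∷ (((dead , false) , (gap₁ , true , true)) , ((dead , false) , (gap₁ , true , false))) ∷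
  (((gap₁ , true) , (gap₁ , true , true)) , ((dead , false) , (gap₁ , true , false))) ∷ (((gap₁ , false) , (gap₁ , true , false)) , ((gap₁ , true) , (gap₁ , true , false))) ∷
  (((gap₂ , false) , (gap₂ , true , false)) , ((gap₂ , true) , (gap₂ , true , false))) ∷ (((gap₁ , true) , (gap₁ , true , false)) , ((gap₂ , false) , (gap₂ , false , false))) ∷
  (((one , true) , (one , true , false)) , ((one , true) , (one , true , false))) ∷ (((gap₂ , true) , (gap₂ , true , false)) , ((dead , false) , (gap₂ , false , false))) ∷
  (((gap₁ , true) , (gap₁ , true , false)) , ((gap₁ , true) , (gap₁ , true , false))) ∷ (((gap₂ , true) , (gap₂ , true , false)) , ((gap₂ , true) , (gap₂ , true , false))) ∷
  []

PR-reach : List (DFA.Q (P ⊗ R))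
PR-reach =
  ((start , false) , (start , false , false)) ∷ ((one , false) , (one , false , false)) ∷
  ((dead , false) , (dead , false , false)) ∷ ((many , false) , (many , true , false)) ∷
  ((gap₁ , false) , (gap₁ , false , false)) ∷ ((gap₂ , false) , (gap₂ , false , false)) ∷
  ((one , true) , (one , false , true)) ∷ ((dead , false) , (gap₂ , false , false)) ∷
  ((dead , false) , (one , false , true)) ∷ ((dead , false) , (many , true , true)) ∷
  ((dead , false) , (gap₁ , false , true)) ∷ ((dead , false) , (gap₂ , false , true)) ∷
  ((dead , false) , (gap₁ , true , true)) ∷ ((dead , false) , (gap₂ , true , true)) ∷
  ((many , false) , (many , true , true)) ∷ ((gap₁ , true) , (gap₁ , false , true)) ∷
  ((one , true) , (dead , false , false)) ∷ ((gap₂ , true) , (gap₂ , false , true)) ∷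
  ((many , false) , (dead , false , false)) ∷ ((gap₁ , true) , (dead , false , false)) ∷
  ((gap₂ , true) , (dead , false , false)) ∷ ((gap₁ , false) , (dead , false , false)) ∷
  ((one , false) , (dead , false , false)) ∷ ((gap₂ , false) , (dead , false , false)) ∷
  ((gap₁ , false) , (gap₁ , true , true)) ∷ ((gap₂ , false) , (gap₂ , true , true)) ∷
  ((gap₁ , false) , (gap₁ , true , false)) ∷ ((one , false) , (one , true , false)) ∷
  ((gap₂ , false) , (gap₂ , true , false)) ∷ ((one , true) , (one , true , false)) ∷
  ((dead , false) , (gap₂ , true , false)) ∷ ((dead , false) , (one , true , false)) ∷
  ((dead , false) , (many , true , false)) ∷ ((dead , false) , (gap₁ , true , false)) ∷
  ((gap₁ , true) , (gap₁ , true , false)) ∷ ((gap₂ , true) , (gap₂ , true , false)) ∷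
  []

PR-simulation : List (DFA.Q (P ⊗ R) × DFA.Q (P ⊗ R))
PR-simulation =
  (((one , true) , (one , false , true)) , ((dead , false) , (dead , false , false))) ∷ (((many , false) , (many , true , true)) , ((dead , false) , (dead , false , false))) ∷
  (((one , true) , (one , true , false)) , ((dead , false) , (dead , false , false))) ∷ (((many , false) , (many , true , false)) , ((dead , false) , (dead , false , false))) ∷
  (((one , true) , (one , true , false)) , ((gap₁ , false) , (gap₁ , true , false))) ∷ (((many , false) , (many , true , false)) , ((gap₁ , false) , (gap₁ , true , false))) ∷
  (((dead , false) , (dead , false , false)) , ((dead , false) , (dead , false , false))) ∷ (((one , true) , (one , false , true)) , ((gap₁ , false) , (gap₁ , true , true))) ∷
  (((many , false) , (many , true , true)) , ((gap₁ , false) , (gap₁ , true , true))) ∷ (((one , true) , (one , true , false)) , ((gap₁ , false) , (gap₁ , true , true))) ∷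
  (((many , false) , (many , true , false)) , ((gap₁ , false) , (gap₁ , true , true))) ∷ (((dead , false) , (dead , false , false)) , ((dead , false) , (gap₁ , true , true))) ∷
  (((one , true) , (dead , false , false)) , ((dead , false) , (gap₁ , true , true))) ∷ (((many , false) , (dead , false , false)) , ((dead , false) , (gap₁ , true , true))) ∷
  (((one , true) , (dead , false , false)) , ((gap₁ , false) , (dead , false , false))) ∷ (((many , false) , (dead , false , false)) , ((gap₁ , false) , (dead , false , false))) ∷
  (((one , true) , (dead , false , false)) , ((dead , false) , (dead , false , false))) ∷ (((many , false) , (dead , false , false)) , ((dead , false) , (dead , false , false))) ∷
  (((dead , false) , (one , true , false)) , ((dead , false) , (gap₁ , true , false))) ∷ (((dead , false) , (many , true , false)) , ((dead , false) , (gap₁ , true , false))) ∷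
  (((one , true) , (one , true , false)) , ((dead , false) , (gap₁ , true , false))) ∷ (((many , false) , (many , true , false)) , ((dead , false) , (gap₁ , true , false))) ∷
  (((many , false) , (many , true , false)) , ((dead , false) , (one , true , false))) ∷ (((gap₁ , false) , (gap₁ , true , false)) , ((dead , false) , (gap₂ , true , false))) ∷
  (((one , false) , (one , true , false)) , ((dead , false) , (one , true , false))) ∷ (((gap₂ , false) , (gap₂ , true , false)) , ((dead , false) , (gap₂ , true , false))) ∷
  (((one , true) , (one , true , false)) , ((dead , false) , (one , true , false))) ∷ (((dead , false) , (gap₂ , true , false)) , ((dead , false) , (gap₂ , true , false))) ∷
  (((dead , false) , (one , true , false)) , ((dead , false) , (one , true , false))) ∷ (((dead , false) , (many , true , false)) , ((dead , false) , (many , true , false))) ∷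
  (((dead , false) , (gap₁ , true , false)) , ((dead , false) , (gap₁ , true , false))) ∷ (((many , false) , (many , true , false)) , ((dead , false) , (many , true , false))) ∷
  (((gap₁ , true) , (gap₁ , true , false)) , ((dead , false) , (gap₁ , true , false))) ∷ (((gap₂ , true) , (gap₂ , true , false)) , ((dead , false) , (gap₂ , true , false))) ∷
  (((gap₁ , false) , (gap₁ , true , false)) , ((dead , false) , (gap₁ , true , false))) ∷ (((gap₁ , true) , (gap₁ , true , false)) , ((dead , false) , (gap₂ , true , false))) ∷
  (((dead , false) , (many , true , false)) , ((dead , false) , (one , true , false))) ∷ (((dead , false) , (gap₁ , true , false)) , ((dead , false) , (gap₂ , true , false))) ∷
  (((gap₁ , false) , (dead , false , false)) , ((dead , false) , (dead , false , false))) ∷ (((one , false) , (dead , false , false)) , ((dead , false) , (dead , false , false))) ∷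
  (((gap₂ , false) , (dead , false , false)) , ((dead , false) , (dead , false , false))) ∷ (((gap₁ , true) , (dead , false , false)) , ((dead , false) , (dead , false , false))) ∷
  (((gap₂ , true) , (dead , false , false)) , ((dead , false) , (dead , false , false))) ∷ (((many , false) , (dead , false , false)) , ((one , false) , (dead , false , false))) ∷
  (((gap₁ , false) , (dead , false , false)) , ((gap₂ , false) , (dead , false , false))) ∷ (((one , false) , (dead , false , false)) , ((one , true) , (dead , false , false))) ∷
  (((many , false) , (dead , false , false)) , ((many , false) , (dead , false , false))) ∷ (((gap₁ , false) , (dead , false , false)) , ((gap₁ , true) , (dead , false , false))) ∷
  (((gap₂ , false) , (dead , false , false)) , ((gap₂ , true) , (dead , false , false))) ∷ (((gap₁ , false) , (dead , false , false)) , ((gap₁ , false) , (dead , false , false))) ∷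
  (((one , false) , (dead , false , false)) , ((one , false) , (dead , false , false))) ∷ (((gap₂ , false) , (dead , false , false)) , ((gap₂ , false) , (dead , false , false))) ∷
  (((one , true) , (dead , false , false)) , ((one , true) , (dead , false , false))) ∷ (((gap₁ , true) , (dead , false , false)) , ((gap₁ , true) , (dead , false , false))) ∷
  (((gap₂ , true) , (dead , false , false)) , ((gap₂ , true) , (dead , false , false))) ∷ (((gap₁ , true) , (dead , false , false)) , ((gap₂ , false) , (dead , false , false))) ∷
  (((gap₁ , false) , (dead , false , false)) , ((dead , false) , (gap₂ , true , true))) ∷ (((gap₂ , false) , (dead , false , false)) , ((dead , false) , (gap₂ , true , true))) ∷
  (((dead , false) , (dead , false , false)) , ((dead , false) , (gap₂ , true , true))) ∷ (((gap₁ , true) , (dead , false , false)) , ((dead , false) , (gap₂ , true , true))) ∷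
  (((gap₂ , true) , (dead , false , false)) , ((dead , false) , (gap₂ , true , true))) ∷ (((many , false) , (many , true , false)) , ((one , false) , (dead , false , false))) ∷
  (((gap₁ , false) , (gap₁ , true , false)) , ((gap₂ , false) , (gap₂ , true , true))) ∷ (((one , false) , (one , true , false)) , ((one , true) , (dead , false , false))) ∷
  (((gap₂ , false) , (gap₂ , true , false)) , ((dead , false) , (gap₂ , true , true))) ∷ (((dead , false) , (gap₂ , true , false)) , ((dead , false) , (gap₂ , true , true))) ∷
  (((dead , false) , (one , true , false)) , ((dead , false) , (dead , false , false))) ∷ (((dead , false) , (many , true , false)) , ((dead , false) , (dead , false , false))) ∷
  (((dead , false) , (gap₁ , true , false)) , ((dead , false) , (dead , false , false))) ∷ (((dead , false) , (gap₂ , true , false)) , ((dead , false) , (dead , false , false))) ∷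
  (((many , false) , (many , true , false)) , ((many , false) , (dead , false , false))) ∷ (((gap₁ , false) , (gap₁ , true , false)) , ((gap₁ , true) , (dead , false , false))) ∷
  (((gap₂ , false) , (gap₂ , true , false)) , ((gap₂ , true) , (dead , false , false))) ∷ (((gap₁ , false) , (gap₁ , true , false)) , ((gap₁ , false) , (dead , false , false))) ∷
  (((one , false) , (one , true , false)) , ((one , false) , (dead , false , false))) ∷ (((gap₂ , false) , (gap₂ , true , false)) , ((gap₂ , false) , (dead , false , false))) ∷
  (((one , true) , (one , true , false)) , ((one , true) , (dead , false , false))) ∷ (((gap₁ , true) , (gap₁ , true , false)) , ((gap₁ , true) , (dead , false , false))) ∷
  (((gap₂ , true) , (gap₂ , true , false)) , ((gap₂ , true) , (dead , false , false))) ∷ (((gap₁ , true) , (gap₁ , true , false)) , ((gap₂ , false) , (gap₂ , true , true))) ∷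
  (((gap₂ , true) , (gap₂ , true , false)) , ((dead , false) , (gap₂ , true , true))) ∷ (((many , false) , (many , true , true)) , ((one , false) , (dead , false , false))) ∷
  (((gap₁ , false) , (gap₁ , true , true)) , ((gap₂ , false) , (gap₂ , true , true))) ∷ (((gap₂ , false) , (gap₂ , true , true)) , ((dead , false) , (gap₂ , true , true))) ∷
  (((dead , false) , (gap₂ , true , true)) , ((dead , false) , (gap₂ , true , true))) ∷ (((many , false) , (many , true , true)) , ((many , false) , (dead , false , false))) ∷
  (((gap₁ , false) , (gap₁ , true , true)) , ((gap₁ , false) , (dead , false , false))) ∷ (((gap₂ , false) , (gap₂ , true , true)) , ((gap₂ , false) , (dead , false , false))) ∷
  (((dead , false) , (gap₂ , true , true)) , ((dead , false) , (dead , false , false))) ∷ (((gap₁ , true) , (gap₁ , false , true)) , ((gap₂ , false) , (gap₂ , true , true))) ∷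
  (((gap₂ , true) , (gap₂ , false , true)) , ((dead , false) , (gap₂ , true , true))) ∷ (((dead , false) , (gap₂ , false , true)) , ((dead , false) , (gap₂ , true , true))) ∷
  (((many , false) , (many , true , false)) , ((one , false) , (one , true , false))) ∷ (((gap₁ , false) , (gap₁ , true , false)) , ((gap₂ , false) , (gap₂ , true , false))) ∷
  (((one , false) , (one , true , false)) , ((one , true) , (one , true , false))) ∷ (((many , false) , (many , true , false)) , ((many , false) , (many , true , false))) ∷
  (((gap₁ , false) , (gap₁ , true , false)) , ((gap₁ , true) , (gap₁ , true , false))) ∷ (((gap₂ , false) , (gap₂ , true , false)) , ((gap₂ , true) , (gap₂ , true , false))) ∷
  (((gap₁ , false) , (gap₁ , true , false)) , ((gap₁ , false) , (gap₁ , true , false))) ∷ (((one , false) , (one , true , false)) , ((one , false) , (one , true , false))) ∷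
  (((gap₂ , false) , (gap₂ , true , false)) , ((gap₂ , false) , (gap₂ , true , false))) ∷ (((one , true) , (one , true , false)) , ((one , true) , (one , true , false))) ∷
  (((gap₁ , true) , (gap₁ , true , false)) , ((gap₁ , true) , (gap₁ , true , false))) ∷ (((gap₂ , true) , (gap₂ , true , false)) , ((gap₂ , true) , (gap₂ , true , false))) ∷
  (((gap₁ , true) , (gap₁ , true , false)) , ((gap₂ , false) , (gap₂ , true , false))) ∷ (((gap₁ , false) , (gap₁ , true , false)) , ((dead , false) , (dead , false , false))) ∷
  (((one , false) , (one , true , false)) , ((dead , false) , (dead , false , false))) ∷ (((gap₂ , false) , (gap₂ , true , false)) , ((dead , false) , (dead , false , false))) ∷
  (((gap₁ , true) , (gap₁ , true , false)) , ((dead , false) , (dead , false , false))) ∷ (((gap₂ , true) , (gap₂ , true , false)) , ((dead , false) , (dead , false , false))) ∷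
  (((gap₁ , false) , (gap₁ , true , true)) , ((dead , false) , (dead , false , false))) ∷ (((gap₂ , false) , (gap₂ , true , true)) , ((dead , false) , (dead , false , false))) ∷
  (((gap₁ , true) , (gap₁ , false , true)) , ((dead , false) , (dead , false , false))) ∷ (((gap₂ , true) , (gap₂ , false , true)) , ((dead , false) , (dead , false , false))) ∷
  (((dead , false) , (gap₂ , false , true)) , ((dead , false) , (dead , false , false))) ∷
  []

module InvP = MoveInvariance P (start , false) P-reach P-simulation
module InvPQ = MoveInvariance (P ⊗ Q) ((start , false) , (start , false , false)) PQ-reach PQ-simulation
module InvPR = MoveInvariance (P ⊗ R) ((start , false) , (start , false , false)) PR-reach PR-simulation

module SoundP = InvP.Sound refl refl refl refl
module SoundPQ = InvPQ.Sound refl refl refl refl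
module SoundPR = InvPR.Sound refl refl refl refl

-- The invariant of reachable words

flat-shadow : ∀ N → flat N ≗ fromShadow (ones N) (+ 0)
flat-shadow N (+ n) = trans flat-at (sym (fromShadow-at (ones N) (+ 0) n))
  where
  <ℤ-<ℕ : ⌊ + n ℤ.<? + N ⌋ ≡ ⌊ n ℕ.<? N ⌋
  <ℤ-<ℕ with n ℕ.<? N
  ... | yes _ = refl
  ... | no _ = refl
  flat-at : flat N (+ n) ≡ letter (ones N) n
  flat-at rewrite <ℤ-<ℕ with n ℕ.<? N
  ... | yes lt = sym (letter-ones N n lt)
  ... | no ge = sym (letter-beyond (ones N) n (subst (_≤ n) (sym (LP.length-replicate N)) (ℕP.≮⇒≥ ge)))
flat-shadow N -[1+ n ] = refl

count : List Bool → ℕ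
count [] = 0
count (true ∷ w) = suc (count w)
count (false ∷ w) = count w

count-++ : ∀ x y → count (x ++ y) ≡ count x + count y
count-++ [] y = refl
count-++ (true ∷ x) y = cong suc (count-++ x y)
count-++ (false ∷ x) y = count-++ x y

count-ones : ∀ n → count (ones n) ≡ n
count-ones zero = refl
count-ones (suc n) = cong suc (count-ones n)

count-ones-++ : ∀ n w → count (ones n ++ w) ≡ n + count w
count-ones-++ zero w = refl
count-ones-++ (suc n) w = cong suc (count-ones-++ n w)

length-ones-++ : ∀ n (w : List Bool) → length (ones n ++ w) ≡ n + length w
length-ones-++ zero w = refl
length-ones-++ (suc n) w = cong suc (length-ones-++ n w)

module _ (u : List Bool) (a c : ℕ) where
  count-gapped : ∀ v → count (u ++ ones (suc a) ++ false ∷ false ∷ ones (suc c) ++ v) ≡ count u + (suc a + (suc c + count v))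
  count-gapped v = trans (count-++ u _)
    (cong (count u ℕ.+_) (trans (count-ones-++ (suc a) _) (cong (suc a ℕ.+_) (count-ones-++ (suc c) v))))

  count-adjacent : ∀ v → count (u ++ false ∷ ones (suc a) ++ ones (suc c) ++ v) ≡ count u + (suc a + (suc c + count v))
  count-adjacent v = trans (count-++ u _)
    (cong (count u ℕ.+_) (trans (count-ones-++ (suc a) _) (cong (suc a ℕ.+_) (count-ones-++ (suc c) v))))

adjacent-nil : ∀ u a c → u ++ false ∷ ones (suc a) ++ ones (suc c) ≡ u ++ false ∷ ones (suc a) ++ ones (suc c) ++ []
adjacent-nil u a c = cong (λ z → u ++ false ∷ ones (suc a) ++ z) (sym (LP.++-identityʳ (ones (suc c))))

+-suc-+2 : ∀ N m → N + suc m + 2 ≡ suc (N + m + 2)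
+-suc-+2 N m = cong (_+ 2) (ℕP.+-suc N m)

wordMove-count : ∀ {p W c'} → WordMove (p , W) c' → count (proj₂ c') ≡ count W
wordMove-count (inner p u v a c) = trans (count-gapped u a c v) (sym (count-adjacent u a c (false ∷ v)))
wordMove-count (leftEnd p v a c) = trans (count-gapped [] a c v) (sym (count-adjacent [] a c (false ∷ v)))
wordMove-count (rightEnd p u a c) =
  trans (cong count (snoc-nil u a c)) (trans (count-gapped u a c []) (sym (trans (cong count (adjacent-nil u a c)) (count-adjacent u a c []))))
wordMove-count (bothEnds p a c) =
  trans (cong count (snoc-nil [] a c)) (trans (count-gapped [] a c []) (sym (trans (cong count (adjacent-nil [] a c)) (count-adjacent [] a c []))))

module _ (u : List Bool) (a c : ℕ) where
  length-gapped : ∀ v → length (u ++ ones (suc a) ++ false ∷ false ∷ ones (suc c) ++ v) ≡ length u + (suc a + suc (suc (suc c + length v)))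
  length-gapped v = trans (LP.length-++ u)
    (cong (length u ℕ.+_) (trans (length-ones-++ (suc a) _) (cong (λ z → suc a + suc (suc z)) (length-ones-++ (suc c) v))))

  length-adjacent : ∀ v → length (u ++ false ∷ ones (suc a) ++ ones (suc c) ++ v) ≡ length u + suc (suc a + (suc c + length v))
  length-adjacent v = trans (LP.length-++ u)
    (cong (length u ℕ.+_) (cong suc (trans (length-ones-++ (suc a) _) (cong (suc a ℕ.+_) (length-ones-++ (suc c) v)))))

data Has00 : List Bool → Set where
  at-head : ∀ w → Has00 (false ∷ false ∷ w)
  later : ∀ b w → Has00 w → Has00 (b ∷ w)

has00-++ : ∀ u w → Has00 w → Has00 (u ++ w)
has00-++ [] w h = h
has00-++ (x ∷ u) w h = later x _ (has00-++ u w h)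

has00-gapped : ∀ u a w → Has00 (u ++ ones (suc a) ++ false ∷ false ∷ w)
has00-gapped u a w = has00-++ u _ (has00-++ (ones (suc a)) _ (at-head w))

-- The placed word (-[1+ m ] , W) has its leftmost violinist in room -(m+1) and
-- its rightmost one in room length W - m - 2; Q and R constrain W while the
-- right end is still in room N or the left end still in room -1.
record Invariant (N m : ℕ) (W : List Bool) : Set where
  field
    acceptsP   : InvP.Accepts W
    count≡N    : count W ≡ N
    rightEnd≥N : N + m + 2 ≤ length W
    rightEnd=N : length W ≤ N + m + 2 → InvPQ.Accepts W
    leftEnd=-1 : m ≡ 0 → InvPR.Accepts W
    has00      : Has00 W

Reached : ℕ → Config → Set
Reached N c = Σ ℕ λ m → Σ (List Bool) λ W → (c ≡ (-[1+ m ] , W)) × Invariant N m W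

¬false∈ones : ∀ u w N → u ++ false ∷ w ≢ ones N
¬false∈ones [] w zero ()
¬false∈ones [] w (suc N) ()
¬false∈ones (x ∷ u) w zero ()
¬false∈ones (x ∷ u) w (suc N) e = ¬false∈ones u w N (cong (λ { [] → [] ; (_ ∷ t) → t }) e)

first-move : ∀ N {p W c'} → WordMove (p , W) c' → p ≡ + 0 → W ≡ ones N → Reached N c'
first-move N (inner _ u _ _ _) _ e = ⊥-elim (¬false∈ones u _ N e)
first-move N (leftEnd _ v a c) _ e =
  ⊥-elim (¬false∈ones (ones (suc a) ++ ones (suc c)) v N (trans (LP.++-assoc (ones (suc a)) _ _) e))
first-move N (rightEnd _ u _ _) _ e = ⊥-elim (¬false∈ones u _ N e)
first-move N (bothEnds _ a c) refl e = 0 , W , refl , record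
  { acceptsP   = SoundP.initial-accepts refl a c
  ; count≡N    = trans (cong count (snoc-nil [] a c)) (trans (count-gapped [] a c []) (trans (cong (λ n → suc a + n) (ℕP.+-identityʳ (suc c))) a+c≡N))
  ; rightEnd≥N = ℕP.≤-reflexive (trans (cong (λ n → n + 0 + 2) (sym a+c≡N)) (trans (length-identity a c) (sym length-W)))
  ; rightEnd=N = λ _ → SoundPQ.initial-accepts refl a c
  ; leftEnd=-1 = λ _ → SoundPR.initial-accepts refl a c
  ; has00      = has00-gapped [] a _ }
  where
  W = ones (suc a) ++ false ∷ false ∷ ones (suc c)
  a+c≡N : suc a + suc c ≡ N
  a+c≡N = trans (sym (trans (count-++ (ones (suc a)) (ones (suc c))) (cong₂ _+_ (count-ones (suc a)) (count-ones (suc c)))))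
                (trans (cong count e) (count-ones N))
  length-W : length W ≡ suc a + suc (suc (suc c))
  length-W = trans (length-ones-++ (suc a) _) (cong (λ z → suc a + suc (suc z)) (LP.length-replicate (suc c)))
  length-identity : ∀ a c → suc a + suc c + 0 + 2 ≡ suc a + suc (suc (suc c))
  length-identity = NS.solve-∀

length-inner : ∀ u v a c → length (u ++ ones (suc a) ++ false ∷ false ∷ ones (suc c) ++ v) ≡
                          length (u ++ false ∷ ones (suc a) ++ ones (suc c) ++ false ∷ v)
length-inner u v a c = trans (length-gapped u a c v)
  (trans (cong (length u ℕ.+_) (identity a c (length v))) (sym (length-adjacent u a c (false ∷ v))))
  where identity : ∀ a c v → suc a + suc (suc (suc c + v)) ≡ suc (suc a + (suc c + suc v))
        identity = NS.solve-∀

length-leftEnd : ∀ v a c → length (ones (suc a) ++ false ∷ false ∷ ones (suc c) ++ v) ≡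
                           suc (length (ones (suc a) ++ ones (suc c) ++ false ∷ v))
length-leftEnd v a c = trans (length-gapped [] a c v) (trans (identity a c (length v)) (sym (length-adjacent [] a c (false ∷ v))))
  where identity : ∀ a c v → suc a + suc (suc (suc c + v)) ≡ suc (suc a + (suc c + suc v))
        identity = NS.solve-∀

length-rightEnd : ∀ u a c → length (u ++ ones (suc a) ++ false ∷ false ∷ ones (suc c)) ≡
                            suc (length (u ++ false ∷ ones (suc a) ++ ones (suc c)))
length-rightEnd u a c = trans (cong length (snoc-nil u a c)) (trans (length-gapped u a c [])
  (trans (cong (length u ℕ.+_) (identity a c)) (trans (ℕP.+-suc (length u) _)
    (cong suc (sym (trans (cong length (adjacent-nil u a c)) (length-adjacent u a c [])))))))
  where identity : ∀ a c → suc a + suc (suc (suc c + 0)) ≡ suc (suc (suc a + (suc c + 0)))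
        identity = NS.solve-∀

length-bothEnds : ∀ a c → length (ones (suc a) ++ false ∷ false ∷ ones (suc c)) ≡
                          suc (suc (length (ones (suc a) ++ ones (suc c))))
length-bothEnds a c = trans (cong length (snoc-nil [] a c)) (trans (length-gapped [] a c []) (trans (identity a c)
  (cong suc (sym (trans (cong length (adjacent-nil [] a c)) (length-adjacent [] a c []))))))
  where identity : ∀ a c → suc a + suc (suc (suc c + 0)) ≡ suc (suc (suc a + (suc c + 0)))
        identity = NS.solve-∀

-- Only the left end moves by leftEnd and bothEnds moves (m grows) and only the
-- right end by rightEnd and bothEnds moves (the length grows beyond N + m + 2),
-- so the conditions on Q and R are vacuous after those moves.
next-move : ∀ N m W {c'} → WordMove (-[1+ m ] , W) c' → Invariant N m W → Reached N c'
next-move N m _ (inner _ u v a c) inv = m , _ , refl , record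
  { acceptsP   = SoundP.inner-preserves refl u v a c acceptsP
  ; count≡N    = trans (wordMove-count (inner -[1+ m ] u v a c)) count≡N
  ; rightEnd≥N = subst (N + m + 2 ≤_) (sym (length-inner u v a c)) rightEnd≥N
  ; rightEnd=N = λ le → SoundPQ.inner-preserves refl u v a c (rightEnd=N (subst (_≤ N + m + 2) (length-inner u v a c) le))
  ; leftEnd=-1 = λ e → SoundPR.inner-preserves refl u v a c (leftEnd=-1 e)
  ; has00      = has00-gapped u a _ }
  where
  open Invariant inv
next-move N m _ (leftEnd _ v a c) inv = suc m , _ , refl , record
  { acceptsP   = SoundP.leftEnd-preserves refl v a c acceptsP
  ; count≡N    = trans (wordMove-count (leftEnd -[1+ m ] v a c)) count≡N
  ; rightEnd≥N = subst₂ _≤_ (sym (+-suc-+2 N m)) (sym (length-leftEnd v a c)) (s≤s rightEnd≥N)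
  ; rightEnd=N = λ le → SoundPQ.leftEnd-preserves refl v a c (rightEnd=N (ℕP.≤-pred (subst₂ _≤_ (length-leftEnd v a c) (+-suc-+2 N m) le)))
  ; leftEnd=-1 = λ ()
  ; has00      = has00-gapped [] a _ }
  where
  open Invariant inv
next-move N m _ (rightEnd _ u a c) inv = m , _ , refl , record
  { acceptsP   = SoundP.rightEnd-preserves refl u a c acceptsP
  ; count≡N    = trans (wordMove-count (rightEnd -[1+ m ] u a c)) count≡N
  ; rightEnd≥N = subst (N + m + 2 ≤_) (sym (length-rightEnd u a c)) (ℕP.m≤n⇒m≤1+n rightEnd≥N)
  ; rightEnd=N = λ le → ⊥-elim (ℕP.<-irrefl refl (ℕP.<-≤-trans (subst (_≤ N + m + 2) (length-rightEnd u a c) le) rightEnd≥N))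
  ; leftEnd=-1 = λ e → SoundPR.rightEnd-preserves refl u a c (leftEnd=-1 e)
  ; has00      = has00-gapped u a _ }
  where
  open Invariant inv
next-move N m _ (bothEnds _ a c) inv = suc m , _ , refl , record
  { acceptsP   = SoundP.bothEnds-preserves refl a c acceptsP
  ; count≡N    = trans (wordMove-count (bothEnds -[1+ m ] a c)) count≡N
  ; rightEnd≥N = subst₂ _≤_ (sym (+-suc-+2 N m)) (sym (length-bothEnds a c)) (s≤s (ℕP.m≤n⇒m≤1+n rightEnd≥N))
  ; rightEnd=N = λ le → ⊥-elim (ℕP.<-irrefl refl (ℕP.<-≤-trans (ℕP.≤-pred (subst₂ _≤_ (length-bothEnds a c) (+-suc-+2 N m) le)) rightEnd≥N))
  ; leftEnd=-1 = λ ()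
  ; has00      = has00-gapped [] a _ }
  where
  open Invariant inv

ReachedState : ℕ → State → Set
ReachedState N a = (a ≗ flat N) ⊎ Σ ℕ λ m → Σ (List Bool) λ W → (a ≗ fromShadow W -[1+ m ]) × Invariant N m W

reachable-invariant : ∀ N {a} → Reachable (flat N) a → ReachedState N a
reachable-invariant N (here h) = inj₁ h
reachable-invariant N (step r mv) with reachable-invariant N r
... | inj₁ hT with ShadowMove.Move⇒wordMove _ (+ 0) (ones N) (λ i → trans (hT i) (flat-shadow N i)) mv
...   | _ , st , hU with first-move N st refl refl
...     | m , W , refl , inv = inj₂ (m , W , hU , inv)
reachable-invariant N (step r mv) | inj₂ (m , W , hT , inv) with ShadowMove.Move⇒wordMove _ -[1+ m ] W hT mv
...   | _ , st , hU with next-move N m W st inv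
...     | m' , W' , refl , inv' = inj₂ (m' , W' , hU , inv')

-- Final words

alternating : ℕ → List Bool
alternating zero = []
alternating (suc x) = false ∷ true ∷ alternating x

finalWord : ℕ → ℕ → List Bool
finalWord x y = true ∷ alternating x ++ false ∷ false ∷ true ∷ alternating y

-- F's local gap function, restated so that it can be reasoned about.
F-gap : ℕ → ℕ → List Bool
F-gap k j = (if ⌊ j ℕ.≟ k ⌋ then false ∷ false ∷ [] else false ∷ []) ++ true ∷ []

F-gaps : ℕ → ℕ → ℕ → List Bool
F-gaps k j zero = []
F-gaps k j (suc n) = F-gap k (suc j) ++ F-gaps k (suc j) n

applyUpTo-cong : ∀ {f g : ℕ → ℕ} n → (∀ i → f i ≡ g i) → applyUpTo f n ≡ applyUpTo g n
applyUpTo-cong zero h = refl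
applyUpTo-cong (suc n) h = cong₂ _∷_ (h 0) (applyUpTo-cong n (λ i → h (suc i)))

map-applyUpTo : ∀ (f g : ℕ → ℕ) n → map f (applyUpTo g n) ≡ applyUpTo (λ i → f (g i)) n
map-applyUpTo f g zero = refl
map-applyUpTo f g (suc n) = cong (f (g 0) ∷_) (map-applyUpTo f (λ i → g (suc i)) n)

concatMap-F-gap : ∀ k j n → concatMap (F-gap k) (applyUpTo (λ i → suc (j + i)) n) ≡ F-gaps k j n
concatMap-F-gap k j zero = refl
concatMap-F-gap k j (suc n) = cong₂ _++_ (cong (F-gap k) (cong suc (ℕP.+-identityʳ j)))
  (trans (cong (concatMap (F-gap k)) (applyUpTo-cong n (λ i → cong suc (ℕP.+-suc j i)))) (concatMap-F-gap k (suc j) n))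

F≡F-gaps : ∀ N k → F N k ≡ true ∷ F-gaps k 0 (N ∸ 1)
F≡F-gaps N k = cong (true ∷_) (trans (cong (concatMap (F-gap k)) (map-applyUpTo suc (λ i → i) (N ∸ 1))) (concatMap-F-gap k 0 (N ∸ 1)))

F-gap-≢ : ∀ k j → j ≢ k → F-gap k j ≡ false ∷ true ∷ []
F-gap-≢ k j ne with j ℕ.≟ k
... | yes e = ⊥-elim (ne e)
... | no _ = refl

F-gap-≡ : ∀ k → F-gap k k ≡ false ∷ false ∷ true ∷ []
F-gap-≡ k with k ℕ.≟ k
... | yes _ = refl
... | no ne = ⊥-elim (ne refl)

F-gaps-past : ∀ k j n → k ≤ j → F-gaps k j n ≡ alternating n
F-gaps-past k j zero le = refl
F-gaps-past k j (suc n) le =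
  cong₂ _++_ (F-gap-≢ k (suc j) (λ e → ℕP.<-irrefl (sym e) (s≤s le))) (F-gaps-past k (suc j) n (ℕP.m≤n⇒m≤1+n le))

F-gaps-split : ∀ x j y → F-gaps (suc (j + x)) j (suc x + y) ≡ alternating x ++ false ∷ false ∷ true ∷ alternating y
F-gaps-split zero j y =
  cong₂ _++_ (trans (cong (λ z → F-gap (suc z) (suc j)) (ℕP.+-identityʳ j)) (F-gap-≡ (suc j)))
             (trans (cong (λ z → F-gaps (suc z) (suc j) y) (ℕP.+-identityʳ j)) (F-gaps-past (suc j) (suc j) y ℕP.≤-refl))
F-gaps-split (suc x) j y =
  cong₂ _++_ (F-gap-≢ (suc (j + suc x)) (suc j) (λ e → ℕP.<-irrefl (cong ℕ.pred e) (ℕP.m<m+n j (s≤s z≤n))))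
             (trans (cong (λ z → F-gaps (suc z) (suc j) (suc x + y)) (ℕP.+-suc j x)) (F-gaps-split x (suc j) y))

F≡finalWord : ∀ x y → F (suc x + suc y) (suc x) ≡ finalWord x y
F≡finalWord x y = trans (F≡F-gaps (suc x + suc y) (suc x))
  (cong (true ∷_) (trans (cong (F-gaps (suc x) 0) (ℕP.+-suc x y)) (F-gaps-split x 0 y)))

count-alternating : ∀ x → count (alternating x) ≡ x
count-alternating zero = refl
count-alternating (suc x) = cong suc (count-alternating x)

count-finalWord : ∀ x y → count (finalWord x y) ≡ suc x + suc y
count-finalWord x y = cong suc (trans (count-++ (alternating x) _) (cong₂ _+_ (count-alternating x) (cong suc (count-alternating y))))

length-alternating : ∀ x → length (alternating x) ≡ x + x
length-alternating zero = refl
length-alternating (suc x) = cong suc (trans (cong suc (length-alternating x)) (sym (ℕP.+-suc x x)))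

length-finalWord : ∀ x y → length (finalWord x y) ≡ suc ((x + x) + suc (suc (suc (y + y))))
length-finalWord x y = cong suc (trans (LP.length-++ (alternating x))
  (cong₂ _+_ (length-alternating x) (cong (λ z → suc (suc (suc z))) (length-alternating y))))

NoAdjacentOnes : List Bool → Set
NoAdjacentOnes [] = ⊤
NoAdjacentOnes (false ∷ w) = NoAdjacentOnes w
NoAdjacentOnes (true ∷ []) = ⊤
NoAdjacentOnes (true ∷ false ∷ w) = NoAdjacentOnes (false ∷ w)
NoAdjacentOnes (true ∷ true ∷ w) = ⊥

adjacentOnes? : ∀ W → NoAdjacentOnes W ⊎ Σ ℕ λ k → letter W k ≡ 1 × letter W (suc k) ≡ 1
adjacentOnes? [] = inj₁ tt
adjacentOnes? (false ∷ W) with adjacentOnes? W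
... | inj₁ na = inj₁ na
... | inj₂ (k , e₁ , e₂) = inj₂ (suc k , e₁ , e₂)
adjacentOnes? (true ∷ []) = inj₁ tt
adjacentOnes? (true ∷ true ∷ W) = inj₂ (0 , refl , refl)
adjacentOnes? (true ∷ false ∷ W) with adjacentOnes? (false ∷ W)
... | inj₁ na = inj₁ na
... | inj₂ (k , e₁ , e₂) = inj₂ (suc k , e₁ , e₂)

noAdjacentOnes-letter : ∀ W n → NoAdjacentOnes W → letter W n ≡ 1 → letter W (suc n) ≡ 1 → ⊥
noAdjacentOnes-letter (true ∷ true ∷ W) zero () e₁ e₂
noAdjacentOnes-letter (true ∷ false ∷ W) zero na e₁ ()
noAdjacentOnes-letter (true ∷ []) zero na e₁ ()
noAdjacentOnes-letter (false ∷ W) zero na () e₂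
noAdjacentOnes-letter (false ∷ W) (suc n) na e₁ e₂ = noAdjacentOnes-letter W n na e₁ e₂
noAdjacentOnes-letter (true ∷ false ∷ W) (suc n) na e₁ e₂ = noAdjacentOnes-letter (false ∷ W) n na e₁ e₂
noAdjacentOnes-letter (true ∷ []) (suc n) na () e₂

final⇒noAdjacentOnes : ∀ {a : State} W p → a ≗ fromShadow W p → Final a → NoAdjacentOnes W
final⇒noAdjacentOnes W p h fin with adjacentOnes? W
... | inj₁ na = na
... | inj₂ (k , e₁ , e₂) = ⊥-elim (fin (p ℤ.+ + k , ≡1⇒occupied (trans (h _) (trans (fromShadow-at W p k) e₁)) ,
        ≡1⇒occupied (trans (h _) (trans (cong (fromShadow W p) (offset-suc p k)) (trans (fromShadow-at W p (suc k)) e₂)))))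

noAdjacentOnes⇒final : ∀ W p → NoAdjacentOnes W → Final (fromShadow W p)
noAdjacentOnes⇒final W p na (i , o₁ , o₂) with offset-view p i
... | inj₂ (m , refl) with subst (1 ≤_) (fromShadow-before W p m) o₁
... | ()
noAdjacentOnes⇒final W p na (i , o₁ , o₂) | inj₁ (n , refl) =
  noAdjacentOnes-letter W n na (1≤letter⇒≡1 W n (subst (1 ≤_) (fromShadow-at W p n) o₁))
    (1≤letter⇒≡1 W (suc n) (subst (1 ≤_) (trans (cong (fromShadow W p) (offset-suc p n)) (fromShadow-at W p (suc n))) o₂))

noAdjacentOnes-finalWord : ∀ x y → NoAdjacentOnes (finalWord x y)
noAdjacentOnes-finalWord zero y = tail y
  where tail : ∀ y → NoAdjacentOnes (true ∷ alternating y)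
        tail zero = tt
        tail (suc y) = tail y
noAdjacentOnes-finalWord (suc x) y = noAdjacentOnes-finalWord x y

flat-not-final : ∀ N → 2 ≤ N → ∀ {a : State} → a ≗ flat N → Final a → ⊥
flat-not-final N 2≤N h fin =
  fin (+ 0 , ≡1⇒occupied (trans (h (+ 0)) (trans (flat-shadow N (+ 0)) (letter-ones N 0 (ℕP.≤-trans (s≤s z≤n) 2≤N)))) ,
             ≡1⇒occupied (trans (h (+ 1)) (trans (flat-shadow N (+ 1)) (letter-ones N 1 2≤N))))

module PRun = DFAProperties P
module PQRun = DFAProperties (P ⊗ Q)
module PRRun = DFAProperties (P ⊗ R)

P-dead : ∀ w → PRun.run (dead , false) w ≡ (dead , false)
P-dead [] = refl
P-dead (b ∷ w) = P-dead w

P-dead-rejects : ∀ w → ¬ (PRun.accepting (PRun.run (dead , false) w) ≡ true)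
P-dead-rejects w h with trans (sym (cong PRun.accepting (P-dead w))) h
... | ()

accepted-tail : ∀ W → PRun.accepting (PRun.run (one , true) W) ≡ true → NoAdjacentOnes (true ∷ W) →
  Σ ℕ λ y → W ≡ alternating y
accepted-tail [] _ _ = 0 , refl
accepted-tail (true ∷ W) _ ()
accepted-tail (false ∷ []) () _
accepted-tail (false ∷ true ∷ W) h na = let (y , e) = accepted-tail W h na in suc y , cong (λ z → false ∷ true ∷ z) e
accepted-tail (false ∷ false ∷ []) () _
accepted-tail (false ∷ false ∷ true ∷ W) h na = ⊥-elim (P-dead-rejects W h)
accepted-tail (false ∷ false ∷ false ∷ W) h na = ⊥-elim (P-dead-rejects W h)

accepted-body : ∀ W → PRun.accepting (PRun.run (one , false) W) ≡ true → NoAdjacentOnes (true ∷ W) → Has00 (true ∷ W) →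
  Σ ℕ λ x → Σ ℕ λ y → W ≡ alternating x ++ false ∷ false ∷ true ∷ alternating y
accepted-body [] _ _ (later _ _ ())
accepted-body (true ∷ W) _ () _
accepted-body (false ∷ []) () _ _
accepted-body (false ∷ true ∷ W) h na (later _ _ (later _ _ h00)) =
  let (x , y , e) = accepted-body W h na h00 in suc x , y , cong (λ z → false ∷ true ∷ z) e
accepted-body (false ∷ false ∷ []) () _ _
accepted-body (false ∷ false ∷ false ∷ W) h na _ = ⊥-elim (P-dead-rejects W h)
accepted-body (false ∷ false ∷ true ∷ W) h na _ =
  let (y , e) = accepted-tail W h na in 0 , y , cong (λ z → false ∷ false ∷ true ∷ z) e

accepted-finalWord : ∀ W → InvP.Accepts W → NoAdjacentOnes W → Has00 W → Σ ℕ λ x → Σ ℕ λ y → W ≡ finalWord x y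
accepted-finalWord [] () _ _
accepted-finalWord (false ∷ W) h _ _ = ⊥-elim (P-dead-rejects W h)
accepted-finalWord (true ∷ W) h na (later _ _ h00) =
  let (x , y , e) = accepted-body W h na (later _ _ h00) in x , y , cong (true ∷_) e

PQ-alternating : ∀ x f g w → PQRun.run ((one , f) , (one , true , g)) (alternating x ++ w) ≡ PQRun.run ((one , f) , (one , true , g)) w
PQ-alternating zero f g w = refl
PQ-alternating (suc x) f g w = PQ-alternating x f g w

Q-rejects : ∀ x y → ¬ InvPQ.Accepts (finalWord (suc x) y)
Q-rejects x y h
  rewrite PQ-alternating x false false (false ∷ false ∷ true ∷ alternating y)
        | sym (LP.++-identityʳ (alternating y)) | PQ-alternating y true true []
  with h
... | ()

PR-alternating : ∀ x f w → PRRun.run ((one , f) , (one , false , false)) (alternating x ++ w) ≡ PRRun.run ((one , f) , (one , false , false)) w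
PR-alternating zero f w = refl
PR-alternating (suc x) f w = PR-alternating x f w

R-dead : ∀ w s → proj₂ (PRRun.run (s , (dead , false , false)) w) ≡ (dead , false , false)
R-dead [] s = refl
R-dead (b ∷ w) s = R-dead w (DFA.δ P s b)

R-dead-rejects : ∀ s → proj₂ s ≡ (dead , false , false) → PRRun.accepting s ≡ false
R-dead-rejects (s , .(dead , false , false)) refl = BP.∧-zeroʳ (DFA.accepting P s)

R-rejects : ∀ x y → ¬ InvPR.Accepts (finalWord x (suc y))
R-rejects x y h rewrite PR-alternating x false (false ∷ false ∷ true ∷ alternating (suc y))
  with trans (sym h) (R-dead-rejects _ (R-dead (alternating y) (one , true)))
... | ()

Admissible : ℕ → ℕ → ℕ → Set
Admissible x y m = (x ≡ 0 × m ≡ y) ⊎ (y ≡ 0 × m ≡ 0) ⊎ (1 ≤ m × m < x + y)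

FinalPlacement : ℕ → State → Set
FinalPlacement N a = Σ ℕ λ x → Σ ℕ λ y → Σ ℕ λ m →
  N ≡ suc x + suc y × Admissible x y m × a ≗ fromShadow (finalWord x y) -[1+ m ]

admissible : ∀ x y m → m ≤ x + y → (m ≡ x + y → InvPQ.Accepts (finalWord x y)) →
  (m ≡ 0 → InvPR.Accepts (finalWord x y)) → Admissible x y m
admissible x y m le q r with m ℕ.≟ x + y
admissible zero y m le q r | yes e = inj₁ (refl , e)
admissible (suc x) y m le q r | yes e = ⊥-elim (Q-rejects x y (q e))
admissible x y m le q r | no ne with m ℕ.≟ 0
admissible x zero m le q r | no ne | yes e₀ = inj₂ (inj₁ (refl , e₀))
admissible x (suc y) m le q r | no ne | yes e₀ = ⊥-elim (R-rejects x y (r e₀))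
admissible x y m le q r | no ne | no ne₀ = inj₂ (inj₂ (ℕP.n≢0⇒n>0 ne₀ , ℕP.≤∧≢⇒< le ne))

reachable-final⇒placement : ∀ N → 2 ≤ N → ∀ a → Reachable (flat N) a → Final a → FinalPlacement N a
reachable-final⇒placement N 2≤N a reach fin with reachable-invariant N reach
... | inj₁ h = ⊥-elim (flat-not-final N 2≤N h fin)
... | inj₂ (m , W , h , inv) =
  x , y , m , sym N≡ , admissible x y m m≤ (λ e → subst InvPQ.Accepts W≡ (rightEnd=N (ℕP.≤-reflexive (length≡ e))))
                                           (λ e → subst InvPR.Accepts W≡ (leftEnd=-1 e)) ,
  λ i → trans (h i) (cong (λ w → fromShadow w -[1+ m ] i) W≡)
  where
  open Invariant inv
  finalW = accepted-finalWord W acceptsP (final⇒noAdjacentOnes W -[1+ m ] h fin) has00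
  x = proj₁ finalW
  y = proj₁ (proj₂ finalW)
  W≡ : W ≡ finalWord x y
  W≡ = proj₂ (proj₂ finalW)
  N≡ : suc x + suc y ≡ N
  N≡ = trans (sym (count-finalWord x y)) (trans (cong count (sym W≡)) count≡N)
  length-W : length W ≡ (suc x + suc y) + (x + y) + 2
  length-W = trans (cong length W≡) (trans (length-finalWord x y) (length-identity x y))
    where length-identity : ∀ x y → suc ((x + x) + suc (suc (suc (y + y)))) ≡ (suc x + suc y) + (x + y) + 2
          length-identity = NS.solve-∀
  m≤ : m ≤ x + y
  m≤ = ℕP.+-cancelˡ-≤ (suc x + suc y) m (x + y)
         (ℕP.+-cancelʳ-≤ 2 _ _ (subst₂ _≤_ (cong (λ n → n + m + 2) (sym N≡)) length-W rightEnd≥N))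
  length≡ : m ≡ x + y → length W ≡ N + m + 2
  length≡ e = trans length-W (cong (λ z → z + 2) (cong₂ _+_ N≡ (sym e)))

ListedFinal : ℕ → State → Set
ListedFinal N a =
  HasShadowAt a (F N 1) (- (+ (N ∸ 1)))
  ⊎ HasShadowAt a (F N (N ∸ 1)) (- (+ 1))
  ⊎ Σ ℕ (λ r → 1 ≤ r × r ≤ N ∸ 1 ×
      Σ ℤ (λ k → (- (+ (N ∸ 2))) ℤ.≤ k × k ℤ.≤ - (+ 2) × HasShadowAt a (F N r) k))

shadow-F : ∀ {a : State} x y m → a ≗ fromShadow (finalWord x y) -[1+ m ] → HasShadowAt a (F (suc x + suc y) (suc x)) -[1+ m ]
shadow-F x y m h i = trans (h i) (cong (λ W → fromShadow W -[1+ m ] i) (sym (F≡finalWord x y)))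

placement⇒listed : ∀ N a → FinalPlacement N a → ListedFinal N a
placement⇒listed _ a (zero , y , .y , refl , inj₁ (refl , refl) , h) = inj₁ (shadow-F 0 y y h)
placement⇒listed _ a (x , zero , .0 , refl , inj₂ (inj₁ (refl , refl)) , h) =
  inj₂ (inj₁ (subst (λ r → HasShadowAt a (F (suc x + 1) r) -[1+ 0 ]) (sym (ℕP.+-comm x 1)) (shadow-F x 0 0 h)))
placement⇒listed _ a (x , y , m , refl , inj₂ (inj₂ (1≤m , m<x+y)) , h) =
  inj₂ (inj₂ (suc x , s≤s z≤n , subst (suc x ≤_) (sym (ℕP.+-suc x y)) (s≤s (ℕP.m≤m+n x y)) ,
    -[1+ m ] , subst (λ t → - (+ t) ℤ.≤ -[1+ m ]) (sym (cong (_∸ 1) (ℕP.+-suc x y))) (neg-≤ m<x+y) ,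
    ℤ.-≤- 1≤m , shadow-F x y m h))
  where
  neg-≤ : ∀ {m t} → m < t → - (+ t) ℤ.≤ -[1+ m ]
  neg-≤ {t = suc t} lt = ℤ.-≤- (ℕP.≤-pred lt)

-- Move sequences

WordMoves : Config → Config → Set
WordMoves = Star WordMove

reachable-≗ : ∀ {S U U' : State} → Reachable S U → U ≗ U' → Reachable S U'
reachable-≗ (here h) e = here (λ i → trans (sym (e i)) (h i))
reachable-≗ (step r (i , l , r' , o1 , o2 , li , sl , bl , ir , sr , br , ui , ui1 , ul , ur , uo)) e =
  step r (i , l , r' , o1 , o2 , li , sl , bl , ir , sr , br ,
          trans (cong (ℕ._+ 1) (sym (e i))) ui , trans (cong (ℕ._+ 1) (sym (e _))) ui1 ,
          trans (sym (e l)) ul , trans (sym (e r')) ur , (λ j n1 n2 n3 n4 → trans (sym (e j)) (uo j n1 n2 n3 n4)))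

wordMoves-reachable : ∀ {S : State} {c c'} → WordMoves c c' → Reachable S (fromShadow (proj₂ c) (proj₁ c)) → Reachable S (fromShadow
    (proj₂ c') (proj₁ c'))
wordMoves-reachable ε r = r
wordMoves-reachable (s ◅ w) r = wordMoves-reachable w (step r (wordMove⇒Move s (λ _ → refl) (λ _ → refl)))

appendOne : Config → Config
appendOne (p , W) = (p , W ++ true ∷ [])

++-assoc-1 : ∀ (x y : List Bool) → (x ++ y) ++ true ∷ [] ≡ x ++ y ++ true ∷ []
++-assoc-1 x y = LP.++-assoc x y (true ∷ [])

ones-snoc : ∀ n → ones n ++ true ∷ [] ≡ ones (suc n)
ones-snoc zero = refl
ones-snoc (suc n) = cong (true ∷_) (ones-snoc n)

wordMove-appendOne : ∀ {a b} → WordMove a b → WordMove (appendOne a) (appendOne b)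
wordMove-appendOne (inner p u v a c) = subst₂ WordMove
  (cong (p ,_) (sym (trans (++-assoc-1 u _) (cong (λ z → u ++ false ∷ z) (trans (++-assoc-1 (ones (suc a)) _) (cong (ones (suc a) ++_)
      (++-assoc-1 (ones (suc c)) _)))))))
  (cong (p ,_) (sym (trans (++-assoc-1 u _) (cong (u ++_) (trans (++-assoc-1 (ones (suc a)) _) (cong (λ z → ones
      (suc a) ++ false ∷ false ∷ z) (++-assoc-1 (ones (suc c)) _)))))))
  (inner p u (v ++ true ∷ []) a c)
wordMove-appendOne (leftEnd p v a c) = subst₂ WordMove
  (cong (p ,_) (sym (trans (++-assoc-1 (ones (suc a)) _) (cong (ones (suc a) ++_) (++-assoc-1 (ones (suc c)) _)))))
  (cong (ℤ.pred p ,_) (sym (trans (++-assoc-1 (ones (suc a)) _) (cong (λ z → ones (suc a) ++ false ∷ false ∷ z) (++-assoc-1 (ones (suc c)) _)))))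
  (leftEnd p (v ++ true ∷ []) a c)
wordMove-appendOne (rightEnd p u a c) = subst₂ WordMove
  (cong (p ,_) (sym (trans (++-assoc-1 u _) (cong (λ z → u ++ false ∷ z) (trans (++-assoc-1 (ones (suc a)) _) (cong (ones (suc a) ++_)
      (ones-snoc (suc c))))))))
  (cong (p ,_) (sym (trans (++-assoc-1 u _) (cong (u ++_) (trans (++-assoc-1 (ones (suc a)) _) (cong (λ z → ones
      (suc a) ++ false ∷ false ∷ z) (ones-snoc (suc c))))))))
  (rightEnd p u a (suc c))
wordMove-appendOne (bothEnds p a c) = subst₂ WordMove
  (cong (p ,_) (sym (trans (++-assoc-1 (ones (suc a)) _) (cong (ones (suc a) ++_) (ones-snoc (suc c))))))
  (cong (ℤ.pred p ,_) (sym (trans (++-assoc-1 (ones (suc a)) _) (cong (λ z → ones (suc a) ++ false ∷ false ∷ z) (ones-snoc (suc c))))))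
  (bothEnds p a (suc c))

wordMoves-appendOne : ∀ {a b} → WordMoves a b → WordMoves (appendOne a) (appendOne b)
wordMoves-appendOne = gmap appendOne wordMove-appendOne

translate : ℤ → Config → Config
translate t (p , W) = (t ℤ.+ p , W)

wordMove-translate : ∀ t {a b} → WordMove a b → WordMove (translate t a) (translate t b)
wordMove-translate t (inner p u v a c) = inner (t ℤ.+ p) u v a c
wordMove-translate t (leftEnd p v a c) = subst₂ WordMove refl (cong (_, _) (sym (ℤP.+-pred t p))) (leftEnd (t ℤ.+ p) v a c)
wordMove-translate t (rightEnd p u a c) = rightEnd (t ℤ.+ p) u a c
wordMove-translate t (bothEnds p a c) = subst₂ WordMove refl (cong (_, _) (sym (ℤP.+-pred t p))) (bothEnds (t ℤ.+ p) a c)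

wordMoves-translate : ∀ t {a b} → WordMoves a b → WordMoves (translate t a) (translate t b)
wordMoves-translate t = gmap (translate t) (wordMove-translate t)

-- The reflection j ↦ -j of the rooms; it exchanges leftEnd and rightEnd moves.
mirror : Config → Config
mirror (p , W) = (ℤ.1ℤ ℤ.- (p ℤ.+ + length W) , reverse W)

++-assoc₆ : ∀ (a b c d e f : List Bool) → ((((a ++ b) ++ c) ++ d) ++ e) ++ f ≡ a ++ b ++ c ++ d ++ e ++ f
++-assoc₆ a b c d e f = trans (LP.++-assoc (((a ++ b) ++ c) ++ d) e f) (trans (LP.++-assoc ((a ++ b) ++ c) d (e ++ f))
                   (trans (LP.++-assoc (a ++ b) c (d ++ e ++ f)) (LP.++-assoc a b (c ++ d ++ e ++ f))))

reverse-adjacent : ∀ u A B v → reverse (u ++ false ∷ A ++ B ++ false ∷ v) ≡ reverse v ++ false ∷ reverse B ++ reverse A ++ false ∷ reverse u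
reverse-adjacent u A B v = trans (LP.reverse-++ u (false ∷ A ++ B ++ false ∷ v)) (trans (cong (_++ reverse u) (LP.unfold-reverse false
    (A ++ B ++ false ∷ v)))
  (trans (cong (λ z → (z ++ false ∷ []) ++ reverse u) (LP.reverse-++ A (B ++ false ∷ v)))
  (trans (cong (λ z → ((z ++ reverse A) ++ false ∷ []) ++ reverse u) (LP.reverse-++ B (false ∷ v)))
  (trans (cong (λ z → (((z ++ reverse B) ++ reverse A) ++ false ∷ []) ++ reverse u) (LP.unfold-reverse false v))
  (++-assoc₆ (reverse v) (false ∷ []) (reverse B) (reverse A) (false ∷ []) (reverse u))))))

reverse-gapped : ∀ u A B v → reverse (u ++ A ++ false ∷ false ∷ B ++ v) ≡ reverse v ++ reverse B ++ false ∷ false ∷ reverse A ++ reverse u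
reverse-gapped u A B v = trans (LP.reverse-++ u (A ++ false ∷ false ∷ B ++ v)) (trans (cong (_++ reverse u) (LP.reverse-++ A
    (false ∷ false ∷ B ++ v)))
  (trans (cong (λ z → (z ++ reverse A) ++ reverse u) (LP.unfold-reverse false (false ∷ B ++ v)))
  (trans (cong (λ z → ((z ++ false ∷ []) ++ reverse A) ++ reverse u) (LP.unfold-reverse false (B ++ v)))
  (trans (cong (λ z → (((z ++ false ∷ []) ++ false ∷ []) ++ reverse A) ++ reverse u) (LP.reverse-++ B v))
  (++-assoc₆ (reverse v) (reverse B) (false ∷ []) (false ∷ []) (reverse A) (reverse u))))))

reverse-ones : ∀ n → reverse (ones n) ≡ ones n
reverse-ones zero = refl
reverse-ones (suc n) = trans (LP.unfold-reverse true (ones n)) (trans (cong (_++ true ∷ []) (reverse-ones n)) (ones-snoc n))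

mirror-pred : ∀ (p X : ℤ) → ℤ.1ℤ ℤ.- ((ℤ.-1ℤ ℤ.+ p) ℤ.+ (ℤ.1ℤ ℤ.+ X)) ≡ ℤ.1ℤ ℤ.- (p ℤ.+ X)
mirror-pred = ZS.solve-∀

pred-mirror : ∀ (p X : ℤ) → ℤ.-1ℤ ℤ.+ (ℤ.1ℤ ℤ.- (p ℤ.+ X)) ≡ ℤ.1ℤ ℤ.- (p ℤ.+ (ℤ.1ℤ ℤ.+ X))
pred-mirror = ZS.solve-∀

pred-mirror-pred : ∀ (p X : ℤ) → ℤ.-1ℤ ℤ.+ (ℤ.1ℤ ℤ.- (p ℤ.+ X)) ≡ ℤ.1ℤ ℤ.- ((ℤ.-1ℤ ℤ.+ p) ℤ.+ (ℤ.1ℤ ℤ.+ (ℤ.1ℤ ℤ.+ X)))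
pred-mirror-pred = ZS.solve-∀

mirror-offset-cong : ∀ (p : ℤ) {n m} → n ≡ m → ℤ.1ℤ ℤ.- (p ℤ.+ + n) ≡ ℤ.1ℤ ℤ.- (p ℤ.+ + m)
mirror-offset-cong p refl = refl

++-assoc₄ : ∀ (a b c d : List Bool) → ((a ++ b) ++ c) ++ d ≡ a ++ b ++ c ++ d
++-assoc₄ a b c d = trans (LP.++-assoc (a ++ b) c d) (LP.++-assoc a b (c ++ d))

reverse-adjacent-left : ∀ A B v → reverse (A ++ B ++ false ∷ v) ≡ reverse v ++ false ∷ reverse B ++ reverse A
reverse-adjacent-left A B v = trans (LP.reverse-++ A (B ++ false ∷ v)) (trans (cong (_++ reverse A) (LP.reverse-++ B (false ∷ v)))
  (trans (cong (λ z → (z ++ reverse B) ++ reverse A) (LP.unfold-reverse false v)) (++-assoc₄ (reverse v) (false ∷ []) (reverse B) (reverse A))))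

reverse-adjacent-right : ∀ u A B → reverse (u ++ false ∷ A ++ B) ≡ reverse B ++ reverse A ++ false ∷ reverse u
reverse-adjacent-right u A B = trans (LP.reverse-++ u (false ∷ A ++ B)) (trans (cong (_++ reverse u) (LP.unfold-reverse false (A ++ B)))
  (trans (cong (λ z → (z ++ false ∷ []) ++ reverse u) (LP.reverse-++ A B)) (++-assoc₄ (reverse B) (reverse A) (false ∷ []) (reverse u))))

reverse-gapped-left : ∀ A B v → reverse (A ++ false ∷ false ∷ B ++ v) ≡ reverse v ++ reverse B ++ false ∷ false ∷ reverse A
reverse-gapped-left A B v = trans (reverse-gapped [] A B v) (cong (λ z → reverse v ++ reverse B ++ false ∷ false ∷ z) (LP.++-identityʳ (reverse A)))

reverse-gapped-right : ∀ u A B → reverse (u ++ A ++ false ∷ false ∷ B) ≡ reverse B ++ false ∷ false ∷ reverse A ++ reverse u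
reverse-gapped-right u A B = trans (cong reverse (cong (λ z → u ++ A ++ false ∷ false ∷ z) (sym (LP.++-identityʳ B)))) (reverse-gapped u A B [])

reverse-gapped-both : ∀ A B → reverse (A ++ false ∷ false ∷ B) ≡ reverse B ++ false ∷ false ∷ reverse A
reverse-gapped-both A B = trans (reverse-gapped-right [] A B) (cong (λ z → reverse B ++ false ∷ false ∷ z) (LP.++-identityʳ (reverse A)))

wordMove-mirror : ∀ {a b} → WordMove a b → WordMove (mirror a) (mirror b)
wordMove-mirror (inner p u v a c) = subst₂ WordMove
  (cong₂ _,_ refl (sym (trans (reverse-adjacent u (ones (suc a)) (ones (suc c)) v) (cong₂
      (λ x y → reverse v ++ false ∷ x ++ y ++ false ∷ reverse u) (reverse-ones (suc c)) (reverse-ones (suc a))))))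
  (cong₂ _,_ (mirror-offset-cong p (sym (length-inner u v a c))) (sym (trans (reverse-gapped u (ones (suc a)) (ones (suc c)) v) (cong₂
      (λ x y → reverse v ++ x ++ false ∷ false ∷ y ++ reverse u) (reverse-ones (suc c)) (reverse-ones (suc a))))))
  (inner _ (reverse v) (reverse u) c a)
wordMove-mirror (leftEnd p v a c) = subst₂ WordMove
  (cong₂ _,_ refl (sym (trans (reverse-adjacent-left (ones (suc a)) (ones (suc c)) v) (cong₂ (λ x y → reverse v ++ false ∷ x ++ y)
      (reverse-ones (suc c)) (reverse-ones (suc a))))))
  (cong₂ _,_ (trans (sym (mirror-pred p (+ length (ones (suc a) ++ ones (suc c) ++ false ∷ v)))) (mirror-offset-cong (ℤ.pred p) (sym
      (length-leftEnd v a c))))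
             (sym (trans (reverse-gapped-left (ones (suc a)) (ones (suc c)) v) (cong₂ (λ x y → reverse v ++ x ++ false ∷ false ∷ y)
                 (reverse-ones (suc c)) (reverse-ones (suc a))))))
  (rightEnd _ (reverse v) c a)
wordMove-mirror (rightEnd p u a c) = subst₂ WordMove
  (cong₂ _,_ refl (sym (trans (reverse-adjacent-right u (ones (suc a)) (ones (suc c))) (cong₂ (λ x y → x ++ y ++ false ∷ reverse u)
      (reverse-ones (suc c)) (reverse-ones (suc a))))))
  (cong₂ _,_ (trans (pred-mirror p (+ length (u ++ false ∷ ones (suc a) ++ ones (suc c)))) (mirror-offset-cong p (sym (length-rightEnd u a c))))
             (sym (trans (reverse-gapped-right u (ones (suc a)) (ones (suc c))) (cong₂ (λ x y → x ++ false ∷ false ∷ y ++ reverse u)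
                 (reverse-ones (suc c)) (reverse-ones (suc a))))))
  (leftEnd _ (reverse u) c a)
wordMove-mirror (bothEnds p a c) = subst₂ WordMove
  (cong₂ _,_ refl (sym (trans (LP.reverse-++ (ones (suc a)) (ones (suc c))) (cong₂ _++_ (reverse-ones (suc c)) (reverse-ones (suc a))))))
  (cong₂ _,_ (trans (pred-mirror-pred p (+ length (ones (suc a) ++ ones (suc c)))) (mirror-offset-cong (ℤ.pred p) (sym (length-bothEnds a c))))
             (sym (trans (reverse-gapped-both (ones (suc a)) (ones (suc c))) (cong₂ (λ x y → x ++ false ∷ false ∷ y) (reverse-ones (suc c))
                 (reverse-ones (suc a))))))
  (bothEnds _ c a)

wordMoves-mirror : ∀ {a b} → WordMoves a b → WordMoves (mirror a) (mirror b)
wordMoves-mirror = gmap mirror wordMove-mirror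

Reaches : ℕ → ℕ → ℕ → Set
Reaches x y m = WordMoves (+ 0 , ones (suc x + suc y)) (-[1+ m ] , finalWord x y)

alternating′ : ℕ → List Bool
alternating′ zero = []
alternating′ (suc j) = true ∷ false ∷ alternating′ j

alternating-++ : ∀ x w → alternating x ++ false ∷ true ∷ w ≡ false ∷ true ∷ alternating x ++ w
alternating-++ zero w = refl
alternating-++ (suc x) w = cong (λ z → false ∷ true ∷ z) (alternating-++ x w)

alternating′-++ : ∀ j w → alternating′ j ++ true ∷ false ∷ w ≡ true ∷ false ∷ alternating′ j ++ w
alternating′-++ zero w = refl
alternating′-++ (suc j) w = cong (λ z → true ∷ false ∷ z) (alternating′-++ j w)

alternating′-snoc : ∀ j → false ∷ alternating′ j ++ true ∷ [] ≡ alternating (suc j)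
alternating′-snoc zero = refl
alternating′-snoc (suc j) = cong (λ z → false ∷ true ∷ z) (alternating′-snoc j)

alternating-cons : ∀ j → true ∷ alternating j ≡ alternating′ j ++ true ∷ []
alternating-cons zero = refl
alternating-cons (suc j) = cong (λ z → true ∷ false ∷ z) (alternating-cons j)

block1100 : List Bool
block1100 = true ∷ true ∷ false ∷ false ∷ []

assoc-snoc : ∀ (P A : List Bool) (x : Bool) (w : List Bool) → (P ++ A ++ x ∷ []) ++ w ≡ P ++ A ++ x ∷ w
assoc-snoc P A x w = trans (LP.++-assoc P (A ++ x ∷ []) w) (cong (P ++_) (LP.++-assoc A (x ∷ []) w))

-- Each inner move turns 10 1100 into 1100 10.
walk-left : ∀ k P j R → WordMoves (k , P ++ alternating′ j ++ block1100 ++ R) (k , P ++ block1100 ++ alternating′ j ++ R)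
walk-left k P zero R = ε
walk-left k P (suc j) R =
  subst₂ WordMove (cong (k ,_) (trans (assoc-snoc P (alternating′ j) true _) (cong (P ++_) (alternating′-++ j _))))
             (cong (k ,_) (assoc-snoc P (alternating′ j) true _))
             (inner k (P ++ alternating′ j ++ true ∷ []) (false ∷ R) 0 0)
  ◅ subst₂ WordMoves refl (cong (k ,_) (cong (λ z → P ++ block1100 ++ z) (alternating′-++ j R))) (walk-left k P j (true ∷ false ∷ R))

finalPrefix : ℕ → List Bool
finalPrefix x = true ∷ alternating x ++ false ∷ false ∷ []

finalWord-split : ∀ x z → finalWord x z ≡ finalPrefix x ++ true ∷ alternating z
finalWord-split x z = cong (true ∷_) (sym (LP.++-assoc (alternating x) (false ∷ false ∷ []) (true ∷ alternating z)))

extend-finalWord : ∀ k x z → WordMoves (k , finalWord x z ++ true ∷ []) (k , finalWord (suc x) z)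
extend-finalWord k x zero = return (subst₂ WordMove
  (cong (k ,_) (cong (true ∷_) (trans (LP.++-assoc (alternating x) (false ∷ []) (false ∷ true ∷ true ∷ [])) (sym (LP.++-assoc
      (alternating x) (false ∷ false ∷ true ∷ []) (true ∷ []))))))
  (cong (k ,_) (cong (true ∷_) (trans (LP.++-assoc (alternating x) (false ∷ []) _) (alternating-++ x (false ∷ false ∷ true ∷ [])))))
  (rightEnd k (true ∷ alternating x ++ false ∷ []) 0 0))
extend-finalWord k x (suc z) =
  let e0 : finalWord x (suc z) ++ true ∷ [] ≡ (finalPrefix x ++ alternating′ z ++ true ∷ []) ++ false ∷ true ∷ true ∷ []
      e0 = trans (cong (_++ true ∷ []) (finalWord-split x (suc z)))
           (trans (LP.++-assoc (finalPrefix x) (true ∷ alternating (suc z)) (true ∷ []))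
           (trans (cong (λ w → finalPrefix x ++ w ++ true ∷ []) (alternating-cons (suc z)))
           (trans (cong (finalPrefix x ++_) (LP.++-assoc (alternating′ (suc z)) (true ∷ []) (true ∷ [])))
           (trans (cong (finalPrefix x ++_) (sym (alternating′-++ z (true ∷ true ∷ []))))
                  (sym (assoc-snoc (finalPrefix x) (alternating′ z) true (false ∷ true ∷ true ∷ [])))))))
      e1 : (finalPrefix x ++ alternating′ z ++ true ∷ []) ++ true ∷ false ∷ false ∷ true ∷ [] ≡ finalPrefix x ++ alternating′ z ++ block1100 ++ true ∷ []
      e1 = assoc-snoc (finalPrefix x) (alternating′ z) true _
      e2 : finalPrefix x ++ block1100 ++ alternating′ z ++ true ∷ [] ≡
          (true ∷ alternating x ++ false ∷ []) ++ false ∷ true ∷ true ∷ false ∷ false ∷ alternating′ z ++ true ∷ []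
      e2 = cong (true ∷_) (trans (LP.++-assoc (alternating x) (false ∷ false ∷ []) (block1100 ++ alternating′ z ++ true ∷ [])) (sym
          (LP.++-assoc (alternating x) (false ∷ []) (false ∷ block1100 ++ alternating′ z ++ true ∷ []))))
      e3 : (true ∷ alternating x ++ false ∷ []) ++ true ∷ false ∷ false ∷ true ∷ false ∷ alternating′ z ++ true ∷ [] ≡ finalWord (suc x) (suc z)
      e3 = trans (cong (true ∷_) (trans (LP.++-assoc (alternating x) (false ∷ []) _) (alternating-++ x _)))
                 (cong (λ w → true ∷ false ∷ true ∷ alternating x ++ false ∷ false ∷ true ∷ w) (alternating′-snoc z))
  in subst₂ WordMove (cong (k ,_) (sym e0)) (cong (k ,_) e1) (rightEnd k (finalPrefix x ++ alternating′ z ++ true ∷ []) 0 0)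
     ◅ (walk-left k (finalPrefix x) z (true ∷ [])
     ◅◅ return (subst₂ WordMove (cong (k ,_) (sym e2)) (cong (k ,_) e3) (inner k (true ∷ alternating x ++ false ∷ [])
         (false ∷ alternating′ z ++ true ∷ []) 0 0)))

spread : ∀ k j t → WordMoves (k , alternating′ j ++ true ∷ false ∷ false ∷ ones (3 + t)) (k , alternating′ (t + j) ++ true ∷ false ∷ false ∷ ones 3)
spread k j zero = ε
spread k j (suc t) =
  subst₂ WordMove (cong (k ,_) (LP.++-assoc (alternating′ j) (true ∷ false ∷ []) _))
             (cong (k ,_) (trans (LP.++-assoc (alternating′ j) (true ∷ false ∷ []) _) (alternating′-++ j _)))
             (rightEnd k (alternating′ j ++ true ∷ false ∷ []) 0 (suc (suc t)))
  ◅ subst₂ WordMoves refl (cong (λ n → k , alternating′ n ++ true ∷ false ∷ false ∷ ones 3) (ℕP.+-suc t j)) (spread k (suc j) t)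

reaches-0-y-1 : ∀ t → Reaches 0 (2 + t) 1
reaches-0-y-1 t = return (bothEnds (+ 0) 0 (suc (suc t)))
  ◅◅ (subst₂ WordMoves refl (cong (λ n → -[1+ 0 ] , alternating′ n ++ true ∷ false ∷ false ∷ ones 3) (ℕP.+-identityʳ t)) (spread -[1+ 0 ] 0 t)
  ◅◅ (subst₂ WordMove (cong (_ ,_) (LP.++-assoc (alternating′ t) (true ∷ false ∷ []) _))
                 (cong (_ ,_) (trans (LP.++-assoc (alternating′ t) (true ∷ false ∷ []) _) (alternating′-++ t _)))
                 (rightEnd -[1+ 0 ] (alternating′ t ++ true ∷ false ∷ []) 1 0)
  ◅ (walk-left -[1+ 0 ] [] (suc t) (true ∷ [])
  ◅◅ return (subst₂ WordMove refl (cong (-[1+ 1 ] ,_) (cong (λ w → true ∷ false ∷ false ∷ true ∷ w) (alternating′-snoc (suc t))))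
                 (leftEnd -[1+ 0 ] (false ∷ alternating′ (suc t) ++ true ∷ []) 0 0)))))

reverse-finalWord : ∀ x y → reverse (finalWord y x) ≡ finalWord x y
reverse-finalWord x y =
  trans (cong reverse (sym (shape-Px' y x)))
  (trans (LP.reverse-++ (true ∷ alternating y) (false ∷ false ∷ true ∷ alternating x))
  (trans (cong (_++ reverse (true ∷ alternating y)) (LP.unfold-reverse false (false ∷ true ∷ alternating x)))
  (trans (cong (λ z → (z ++ false ∷ []) ++ reverse (true ∷ alternating y)) (LP.unfold-reverse false (true ∷ alternating x)))
  (trans (cong (λ z → ((z ++ false ∷ []) ++ false ∷ []) ++ reverse (true ∷ alternating y)) (palin x))
  (trans (cong (λ z → ((true ∷ alternating x ++ false ∷ []) ++ false ∷ []) ++ z) (palin y))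
  (trans (LP.++-assoc (true ∷ alternating x ++ false ∷ []) (false ∷ []) (true ∷ alternating y))
         (cong (true ∷_) (LP.++-assoc (alternating x) (false ∷ []) (false ∷ true ∷ alternating y)))))))))
  where
  shape-Px' : ∀ y x → (true ∷ alternating y) ++ false ∷ false ∷ true ∷ alternating x ≡ finalWord y x
  shape-Px' y x = refl
  revAlt' : ∀ j → reverse (alternating′ j) ≡ alternating j
  revAlt' zero = refl
  revAlt' (suc j) = trans (LP.unfold-reverse true (false ∷ alternating′ j)) (trans (cong (_++ true ∷ []) (LP.unfold-reverse false (alternating′ j)))
                    (trans (LP.++-assoc (reverse (alternating′ j)) (false ∷ []) (true ∷ []))
                    (trans (cong (_++ false ∷ true ∷ []) (revAlt' j)) (trans (alternating-++ j []) (cong (λ w → false ∷ true ∷ w)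
                        (LP.++-identityʳ (alternating j)))))))
  palin : ∀ j → reverse (true ∷ alternating j) ≡ true ∷ alternating j
  palin j = trans (cong reverse (alternating-cons j)) (trans (LP.reverse-++ (alternating′ j) (true ∷ [])) (cong (true ∷_) (revAlt' j)))

reaches-mirror : ∀ x y m d → m + d ≡ x + y → Reaches y x m → Reaches x y d
reaches-mirror x y m d e g =
  subst₂ WordMoves from-flat to-final (wordMoves-translate (+ suc (x + y)) (wordMoves-mirror g))
  where
  from-flat : translate (+ suc (x + y)) (mirror (+ 0 , ones (suc y + suc x))) ≡ (+ 0 , ones (suc x + suc y))
  from-flat = cong₂ _,_
    (trans (cong (λ n → + suc (x + y) ℤ.+ (ℤ.1ℤ ℤ.- (+ 0 ℤ.+ + n))) (trans (LP.length-replicate (suc y + suc x)) (length-identity x y)))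
           (position-identity (+ (x + y))))
    (trans (reverse-ones (suc y + suc x)) (cong ones (ℕP.+-comm (suc y) (suc x))))
    where
    length-identity : ∀ x y → suc y + suc x ≡ suc (suc (x + y))
    length-identity = NS.solve-∀
    position-identity : ∀ (X : ℤ) → (ℤ.1ℤ ℤ.+ X) ℤ.+ (ℤ.1ℤ ℤ.- (+ 0 ℤ.+ (+ 2 ℤ.+ X))) ≡ + 0
    position-identity = ZS.solve-∀
  to-final : translate (+ suc (x + y)) (mirror (-[1+ m ] , finalWord y x)) ≡ (-[1+ d ] , finalWord x y)
  to-final = cong₂ _,_
    (trans (cong (λ n → + suc (x + y) ℤ.+ (ℤ.1ℤ ℤ.- (-[1+ m ] ℤ.+ + n))) (trans (length-finalWord y x) (length-identity x y)))
           (trans (cong (λ n → + suc n ℤ.+ (ℤ.1ℤ ℤ.- (-[1+ m ] ℤ.+ + (4 + n + n)))) (sym e)) (position-identity (+ m) (+ d))))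
    (reverse-finalWord x y)
    where
    length-identity : ∀ x y → suc ((y + y) + suc (suc (suc (x + x)))) ≡ 4 + (x + y) + (x + y)
    length-identity = NS.solve-∀
    position-identity : ∀ (M D : ℤ) →
      (ℤ.1ℤ ℤ.+ (M ℤ.+ D)) ℤ.+ (ℤ.1ℤ ℤ.- (ℤ.- (ℤ.1ℤ ℤ.+ M) ℤ.+ (+ 4 ℤ.+ (M ℤ.+ D) ℤ.+ (M ℤ.+ D)))) ≡ ℤ.- (ℤ.1ℤ ℤ.+ D)
    position-identity = ZS.solve-∀

reaches-extend : ∀ x y m → Reaches x y m → Reaches (suc x) y m
reaches-extend x y m r =
  subst₂ WordMoves (cong (+ 0 ,_) (ones-snoc (suc x + suc y))) refl (wordMoves-appendOne r) ◅◅ extend-finalWord -[1+ m ] x y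

-- An admissible triple with x + y = n + 1 is reached from one with x + y = n
-- by reaches-extend, possibly followed by reaches-mirror (which exchanges x
-- and y and replaces m by x + y - m), except for the family reaches-0-y-1.
admissible⇒reaches-suc : ∀ n → (∀ x y m → x + y ≡ n → Admissible x y m → Reaches x y m) →
  ∀ x y m → x + y ≡ suc n → Admissible x y m → Reaches x y m
admissible⇒reaches-suc n ih zero y m e (inj₁ (_ , refl)) =
  reaches-mirror 0 y 0 y refl (subst (λ z → Reaches z 0 0) (sym e)
    (reaches-extend n 0 0 (ih n 0 0 (ℕP.+-identityʳ n) (inj₂ (inj₁ (refl , refl))))))
admissible⇒reaches-suc n ih zero y m () (inj₂ (inj₁ (refl , _)))
admissible⇒reaches-suc n ih zero (suc (suc t)) (suc zero) e (inj₂ (inj₂ _)) = reaches-0-y-1 t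
admissible⇒reaches-suc n ih zero (suc zero) (suc zero) e (inj₂ (inj₂ (_ , s≤s ())))
admissible⇒reaches-suc n ih zero y (suc (suc m)) e (inj₂ (inj₂ (_ , lt))) with ℕP.m≤n⇒∃[o]m+o≡n lt
... | s , refl = reaches-mirror 0 _ (suc s) (suc (suc m)) (shift s m)
  (reaches-extend (suc (suc m) + s) 0 (suc s) (ih (suc (suc m) + s) 0 (suc s) (trans (ℕP.+-identityʳ _) (ℕP.suc-injective e))
    (inj₂ (inj₂ (s≤s z≤n , subst (suc s <_) (sym (ℕP.+-identityʳ _)) (s≤s (s≤s (ℕP.m≤n+m s m))))))))
  where shift : ∀ s m → suc s + suc (suc m) ≡ suc (suc (suc m)) + s
        shift = NS.solve-∀
admissible⇒reaches-suc n ih (suc x) y m e (inj₁ (() , _))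
admissible⇒reaches-suc n ih (suc x) y m e (inj₂ (inj₁ (refl , refl))) =
  reaches-extend x 0 0 (ih x 0 0 (ℕP.suc-injective e) (inj₂ (inj₁ (refl , refl))))
admissible⇒reaches-suc n ih (suc x) y m e (inj₂ (inj₂ (1≤m , lt))) with m ℕ.<? x + y
... | yes lt' = reaches-extend x y m (ih x y m (ℕP.suc-injective e) (inj₂ (inj₂ (1≤m , lt'))))
... | no nlt with ℕP.≤-antisym (ℕP.≤-pred lt) (ℕP.≮⇒≥ nlt)
admissible⇒reaches-suc n ih (suc zero) y m e (inj₂ (inj₂ _)) | no _ | m≡ =
  reaches-extend 0 y m (ih 0 y m (ℕP.suc-injective e) (inj₁ (refl , m≡)))
admissible⇒reaches-suc n ih (suc (suc x)) (suc y) m e (inj₂ (inj₂ _)) | no _ | m≡ =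
  reaches-mirror (suc (suc x)) (suc y) 1 m (cong suc m≡)
    (reaches-extend y (suc (suc x)) 1 (ih y (suc (suc x)) 1 (trans (swap y x) (ℕP.suc-injective e))
      (inj₂ (inj₂ (s≤s z≤n , ℕP.<-≤-trans (s≤s (s≤s z≤n)) (ℕP.m≤n+m (suc (suc x)) y))))))
  where swap : ∀ y x → y + suc (suc x) ≡ suc x + suc y
        swap = NS.solve-∀
admissible⇒reaches-suc n ih (suc (suc x)) zero m e (inj₂ (inj₂ _)) | no _ | m≡ =
  reaches-mirror (suc (suc x)) 0 1 m (cong suc m≡) (reaches-0-y-1 x)

admissible⇒reaches : ∀ n x y m → x + y ≡ n → Admissible x y m → Reaches x y m
admissible⇒reaches zero zero zero zero e _ = return (bothEnds (+ 0) 0 0)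
admissible⇒reaches zero zero zero (suc m) e (inj₁ (_ , ()))
admissible⇒reaches zero zero zero (suc m) e (inj₂ (inj₁ (_ , ())))
admissible⇒reaches zero zero zero (suc m) e (inj₂ (inj₂ (_ , ())))
admissible⇒reaches zero zero (suc y) m () _
admissible⇒reaches zero (suc x) y m () _
admissible⇒reaches (suc n) x y m e adm = admissible⇒reaches-suc n (admissible⇒reaches n) x y m e adm

final-≗ : ∀ {a b : State} → a ≗ b → Final b → Final a
final-≗ e fb (i , o₁ , o₂) = fb (i , subst (1 ≤_) (e i) o₁ , subst (1 ≤_) (e _) o₂)

placement⇒reachable-final : ∀ N a → FinalPlacement N a → Reachable (flat N) a × Final a
placement⇒reachable-final _ a (x , y , m , refl , adm , h) =
  reachable-≗ (wordMoves-reachable (admissible⇒reaches (x + y) x y m refl adm) (here (λ i → sym (flat-shadow (suc x + suc y) i))))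
              (λ i → sym (h i)) ,
  final-≗ h (noAdjacentOnes⇒final (finalWord x y) -[1+ m ] (noAdjacentOnes-finalWord x y))

listed⇒placement : ∀ N → 2 ≤ N → ∀ a → ListedFinal N a → FinalPlacement N a
listed⇒placement (suc zero) (s≤s ()) a _
listed⇒placement (suc (suc y)) _ a (inj₁ h) =
  0 , y , y , refl , inj₁ (refl , refl) , λ i → trans (h i) (cong (λ W → fromShadow W -[1+ y ] i) (F≡finalWord 0 y))
listed⇒placement (suc (suc x)) _ a (inj₂ (inj₁ h)) =
  x , 0 , 0 , N≡ , inj₂ (inj₁ (refl , refl)) ,
  λ i → trans (h i) (cong (λ W → fromShadow W -[1+ 0 ] i) (trans (cong (λ n → F n (suc x)) N≡) (F≡finalWord x 0)))
  where
  N≡ : suc (suc x) ≡ suc x + 1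
  N≡ = cong suc (sym (trans (ℕP.+-suc x 0) (cong suc (ℕP.+-identityʳ x))))
listed⇒placement N _ a (inj₂ (inj₂ (zero , () , _)))
listed⇒placement N _ a (inj₂ (inj₂ (suc x , _ , _ , + n , _ , () , _)))
listed⇒placement N _ a (inj₂ (inj₂ (suc x , _ , _ , -[1+ zero ] , _ , ℤ.-≤- () , _)))
listed⇒placement N 2≤N a (inj₂ (inj₂ (suc x , _ , r≤ , -[1+ suc m ] , lo , _ , h))) with ℕP.m≤n⇒∃[o]m+o≡n r≤
... | y , ey = x , y , suc m , N≡ , inj₂ (inj₂ (s≤s z≤n , m<)) ,
  λ i → trans (h i) (cong (λ W → fromShadow W -[1+ suc m ] i) (trans (cong (λ n → F n (suc x)) N≡) (F≡finalWord x y)))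
  where
  N≡ : N ≡ suc x + suc y
  N≡ = trans (sym (ℕP.m+[n∸m]≡n {1} {N} (ℕP.≤-trans (s≤s z≤n) 2≤N))) (cong suc (trans (sym ey) (sym (ℕP.+-suc x y))))
  neg-≤⇒< : ∀ t m → - (+ t) ℤ.≤ -[1+ m ] → m < t
  neg-≤⇒< (suc t) m (ℤ.-≤- le) = s≤s le
  m< : suc m < x + y
  m< = subst (suc m <_) (trans (cong (_∸ 2) N≡) (cong (_∸ 1) (ℕP.+-suc x y))) (neg-≤⇒< (N ∸ 2) (suc m) lo)

theorem5p14 : (N : ℕ) → 2 ≤ N → (a : State) → FiniteSupport a →
    (Reachable (flat N) a × Final a) ⇔
    (HasShadowAt a (F N 1) (- (+ (N ∸ 1)))
    ⊎ HasShadowAt a (F N (N ∸ 1)) (- (+ 1))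
    ⊎ Σ ℕ (λ r → 1 ≤ r × r ≤ N ∸ 1 ×
    Σ ℤ (λ k → (- (+ (N ∸ 2))) ℤ.≤ k × k ℤ.≤ - (+ 2) ×
    HasShadowAt a (F N r) k)))
theorem5p14 N 2≤N a _ = mk⇔
  (λ (reach , final) → placement⇒listed N a (reachable-final⇒placement N 2≤N a reach final))
  (λ listed → placement⇒reachable-final N a (listed⇒placement N 2≤N a listed))
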